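{- Let $\Gamma$ be an $\mathbb N$-metrised graph without loops, and let $G$ be its underlying graph. Then $\operatorname{dgon}(\Gamma)\ge\operatorname{dgon}(H)$, where $H$ is the graph obtained from $G$ by subdividing every edge $\{e,i(e)\}$ exactly $l(e)-1$ times.
   Context: A graph is $(X,r,i)$: $X$ finite, $r$ idempotent, $i$ involution, $i(x)=x\iff r(x)=x$; vertices $V$ = fixed points, half-edges $H=X\setminus V$, $H_v=\{e:r(e)=v\}$; connected; a loop is an edge with $r(e)=r(i(e))$. $\mathbb N$-metrised: $l:X\to\mathbb N$, $l\circ i=l$, $l(x)=0\iff x\in V$. $\operatorname{PL}(\Gamma)=\{g:V\to\mathbb Z: g(r(e))-g(r(i(e)))\in l(e)\mathbb Z\}$; $\Delta(g)=\sum_v\sum_{e\in H_v}\frac{g(v)-g(r(i(e)))}{l(e)}[v]$; divisors (integer combinations of vertices) $D\sim D'$ iff $D-D'\in\Delta(\operatorname{PL}(\Gamma))$; $|D|=\{E\ge0:E\sim D\}$; $r(D)=\max\{k:|D-F|\ne\emptyset$ for all effective $F$ of degree $k\}$; $\operatorname{dgon}(\Gamma)=\min\{\deg D:r(D)\ge1\}$. For an unmetrised graph $H$, $\operatorname{dgon}(H)$ is this quantity with all lengths equal to $1$. Subdividing an edge once replaces it by a path of two edges through a new vertex. -}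

module Defs where

open import Data.Bool using (Bool; true; false; if_then_else_; not; _∧_)
open import Data.Nat as ℕ using (ℕ; zero; suc; _∸_; _<ᵇ_; _≡ᵇ_)
open import Data.Integer as ℤ using (ℤ; +_; _-_; _≤_)
open import Data.Integer.DivMod using (_/ℕ_)
open import Data.Integer.Divisibility using (_∣_)
open import Data.Fin using (Fin; toℕ)
open import Data.Fin.Properties renaming (_≟_ to _≟F_)
open import Data.List using (List; foldr; map; concatMap; upTo; allFin)
open import Data.List.Membership.Propositional using (_∈_)
open import Data.Product using (Σ; ∃; _×_; _,_)
open import Data.Product.Properties using (≡-dec)
import Data.Nat.Properties as ℕP
open import Relation.Nullary using (¬_; does)
open import Relation.Binary.Definitions using (DecidableEquality)
open import Relation.Binary.PropositionalEquality using (_≡_)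
open import Relation.Binary.Construct.Closure.ReflexiveTransitive using (Star)
open import Function.Bundles using (_⇔_)

-- Raw graphs (X, r, i) with an enumeration of the finite carrier X.
-- Quantification "over X" is quantification over the members of 'elems'.

record RawGraph : Set₁ where
  field
    X     : Set
    elems : List X
    _≟_   : DecidableEquality X
    r     : X → X
    i     : X → X

module _ (G : RawGraph) where
  open RawGraph G

  IsVertex : X → Set
  IsVertex x = r x ≡ x

  isVertex : X → Bool
  isVertex x = does (r x ≟ x)

  ΣX : (X → ℤ) → ℤ
  ΣX f = foldr ℤ._+_ (+ 0) (map f elems)

  Adjacent : X → X → Set
  Adjacent u v = ∃ λ e → e ∈ elems × ¬ IsVertex e × r e ≡ u × r (i e) ≡ v

  record IsGraph : Set where
    field
      r-idem    : ∀ x → x ∈ elems → r (r x) ≡ r x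
      i-invol   : ∀ x → x ∈ elems → i (i x) ≡ x
      fix-iff   : ∀ x → x ∈ elems → (i x ≡ x) ⇔ (r x ≡ x)
      connected : ∀ u v → u ∈ elems → v ∈ elems → IsVertex u → IsVertex v →
                  Star Adjacent u v

  NoLoops : Set
  NoLoops = ∀ e → e ∈ elems → ¬ IsVertex e → ¬ (r e ≡ r (i e))

  record IsMetric (l : X → ℕ) : Set where
    field
      l-i    : ∀ x → x ∈ elems → l (i x) ≡ l x
      l-zero : ∀ x → x ∈ elems → (l x ≡ 0) ⇔ (r x ≡ x)

  unitLength : X → ℕ
  unitLength x = if isVertex x then 0 else 1

  -- divisors: integer combinations of vertices, i.e. maps X → ℤ supported on V
  IsDivisor : (X → ℤ) → Set
  IsDivisor D = ∀ x → x ∈ elems → ¬ IsVertex x → D x ≡ + 0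

  Effective : (X → ℤ) → Set
  Effective D = ∀ x → x ∈ elems → + 0 ≤ D x

  deg : (X → ℤ) → ℤ
  deg D = ΣX (λ x → if isVertex x then D x else + 0)

  -- integer division by a natural number (only used with nonzero divisor)
  quot : ℤ → ℕ → ℤ
  quot a zero    = + 0
  quot a (suc k) = a /ℕ suc k

  module _ (l : X → ℕ) where
    IsPL : (X → ℤ) → Set
    IsPL g = ∀ e → e ∈ elems → (+ l e) ∣ (g (r e) - g (r (i e)))

    Δ : (X → ℤ) → X → ℤ
    Δ g v = ΣX (λ e → if not (isVertex e) ∧ does (r e ≟ v)
                         then quot (g v - g (r (i e))) (l e) else + 0)

    _∼_ : (X → ℤ) → (X → ℤ) → Set
    D ∼ D' = ∃ λ g → IsPL g × (∀ x → x ∈ elems → D x - D' x ≡ Δ g x)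

    LinSysNonempty : (X → ℤ) → Set
    LinSysNonempty D = ∃ λ E → IsDivisor E × Effective E × (E ∼ D)

    -- r(D) ≥ k, i.e. the max of {j : |D - F| ≠ ∅ for all effective F of degree j} is ≥ k
    RankGeq : (X → ℤ) → ℕ → Set
    RankGeq D k = ∃ λ j → k ℕ.≤ j ×
      (∀ F → IsDivisor F → Effective F → deg F ≡ + j →
         LinSysNonempty (λ x → D x - F x))

FinGraph : (n : ℕ) → (Fin n → Fin n) → (Fin n → Fin n) → RawGraph
FinGraph n r i = record { X = Fin n ; elems = allFin n ; _≟_ = _≟F_ ; r = r ; i = i }

-- Carrier Fin n × ℕ; the elements are enumerated by 'elems' below:
--   * a vertex x contributes (x , 0);
--   * a half-edge e of length L contributes (e , j), j < L : the half-edge of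
--     the subdivided edge sitting at position j (counted from r(e), positions
--     0..L along the edge) pointing towards position j+1;
--   * if toℕ e < toℕ (i e) ("e owns the edge"), additionally (e , L + p - 1)
--     for 1 ≤ p ≤ L - 1 : the new vertex at position p counted from r(e).

module Subdivision (n : ℕ) (r i : Fin n → Fin n) (l : Fin n → ℕ) where

  isV : Fin n → Bool
  isV x = does (r x ≟F x)

  own : Fin n → Bool
  own e = toℕ e <ᵇ toℕ (i e)

  size : Fin n → ℕ
  size x = if isV x then 1 else (if own x then l x ℕ.+ (l x ∸ 1) else l x)

  -- vertex of the subdivided edge at position p (0 ≤ p ≤ l e) counted from r(e)
  pos : Fin n → ℕ → Fin n × ℕ
  pos e p = if p ≡ᵇ 0 then (r e , 0)
            else if p ≡ᵇ l e then (r (i e) , 0)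
            else if own e then (e , l e ℕ.+ p ∸ 1)
            else (i e , l e ℕ.+ (l e ∸ p) ∸ 1)

  rH : Fin n × ℕ → Fin n × ℕ
  rH (x , j) = if isV x then (x , j)
               else if j <ᵇ l x then pos x j
               else (x , j)

  iH : Fin n × ℕ → Fin n × ℕ
  iH (x , j) = if isV x then (x , j)
               else if j <ᵇ l x then (i x , l x ∸ 1 ∸ j)
               else (x , j)

  graph : RawGraph
  graph = record
    { X     = Fin n × ℕ
    ; elems = concatMap (λ x → map (x ,_) (upTo (size x))) (allFin n)
    ; _≟_   = ≡-dec _≟F_ ℕP._≟_
    ; r     = rH
    ; i     = iH
    }

subdivide : (n : ℕ) → (Fin n → Fin n) → (Fin n → Fin n) → (Fin n → ℕ) → RawGraph
subdivide = Subdivision.graph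

module Submission where

-- Lift D to the subdivision H by placing no chips on the new vertices; this keeps the degree.
-- To see that the lift D′ has rank ≥ 1 on H, remove a chip at an arbitrary vertex w of H.
-- If w is an old vertex v, the rank of D gives E ≥ 0 with E − (D − j·v) = Δ g on Γ (j ≥ 1).
-- Interpolating g linearly along the edges gives a potential on H whose Laplacian equals Δ g at
-- old vertices and vanishes at new ones, so D′ + Δ₁(interpolate g) is the lift of E + j·v ≥ w.
-- If w is new, inside the edge e from u to v, do this for u and v to get φu and φv, and take
-- φv + min(φu − φv, t), t the value of φu − φv at w: the minimum of two potentials that keep D′
-- effective keeps it effective. Along e, φu − φv is affine; if its slope σ is nonzero the
-- minimum has a kink at w, which puts a chip there. If σ = 0, the result still has a chip at u
-- and at v (u ≠ v as there are no loops), and adding a tent function on e moves one of them to w.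

open import Defs
open import Data.Bool using (true; false; if_then_else_; not; _∧_)
open import Data.Nat as ℕ using (ℕ; zero; suc; _∸_; z≤n; s≤s)
import Data.Nat.Properties as ℕP
import Data.Nat.Divisibility as ℕD
open import Data.Integer as ℤ using (ℤ; +_; -[1+_]; _+_; _-_; _*_; -_; _≤_; _⊓_)
import Data.Integer.Properties as ℤP
open import Data.Integer.DivMod using (_/ℕ_; _%ℕ_; a≡a%ℕn+[a/ℕn]*n)
open import Data.Integer.Tactic.RingSolver using (solve-∀)
open import Data.Fin as Fin using (Fin; toℕ)
import Data.Fin.Properties as FP
open import Data.List using (List; []; _∷_; foldr; map; concatMap; applyUpTo; upTo; allFin; _++_)
import Data.List.Properties as LP
open import Data.List.Membership.Propositional using (_∈_)
import Data.List.Membership.Propositional.Properties as MP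
open import Data.List.Relation.Unary.Any as Any using (here; there)
open import Data.Product using (∃; _×_; _,_; proj₁; proj₂)
open import Data.Product.Properties using (,-injectiveˡ)
open import Data.Sum using (_⊎_; inj₁; inj₂; [_,_]′)
open import Relation.Nullary using (¬_; Dec; does; yes; no; contradiction)
open import Relation.Nullary.Decidable using (dec-true; dec-false)
open import Relation.Binary.PropositionalEquality
open import Function using (_∘_; id)
open import Function.Bundles using (Equivalence)

-- Arithmetic

+[m∸n]≡+m-+n : ∀ {m n} → n ℕ.≤ m → + (m ℕ.∸ n) ≡ + m - + n
+[m∸n]≡+m-+n {m} {n} n≤m = sym (trans (ℤP.m-n≡m⊖n m n) (ℤP.⊖-≥ n≤m))

m≤m+n∸1 : ∀ m n → 1 ℕ.≤ n → m ℕ.≤ m ℕ.+ n ℕ.∸ 1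
m≤m+n∸1 m (suc n) _ = subst (m ℕ.≤_) (sym (ℕP.+-∸-assoc m {suc n} {1} (s≤s z≤n))) (ℕP.m≤m+n m n)

[m+n∸1]+1∸m≡n : ∀ m n → 1 ℕ.≤ m → m ℕ.+ n ℕ.∸ 1 ℕ.+ 1 ℕ.∸ m ≡ n
[m+n∸1]+1∸m≡n m n 1≤m =
  trans (cong (ℕ._∸ m) (ℕP.m∸n+n≡m (ℕP.≤-trans 1≤m (ℕP.m≤m+n m n)))) (ℕP.m+n∸m≡n m n)

≤-double⇒≤-differences : ∀ a b c k → b ℕ.+ c ℕ.+ k ℕ.≤ a ℕ.+ a → + k ≤ (+ a - + b) + (+ a - + c)
≤-double⇒≤-differences a b c k b+c+k≤2a = subst (+ k ≤_) (sym differences≡) (ℤ.+≤+ k≤)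
  where
    b+c≤2a : b ℕ.+ c ℕ.≤ a ℕ.+ a
    b+c≤2a = ℕP.≤-trans (ℕP.m≤m+n (b ℕ.+ c) k) b+c+k≤2a
    k≤ : k ℕ.≤ (a ℕ.+ a) ℕ.∸ (b ℕ.+ c)
    k≤ = subst (ℕ._≤ (a ℕ.+ a) ℕ.∸ (b ℕ.+ c)) (ℕP.m+n∸m≡n (b ℕ.+ c) k) (ℕP.∸-monoˡ-≤ (b ℕ.+ c) b+c+k≤2a)
    regroup : ∀ a b c → (a - b) + (a - c) ≡ (a + a) - (b + c)
    regroup = solve-∀
    differences≡ : (+ a - + b) + (+ a - + c) ≡ + ((a ℕ.+ a) ℕ.∸ (b ℕ.+ c))
    differences≡ = trans (regroup (+ a) (+ b) (+ c))
      (trans (cong₂ _-_ (sym (ℤP.pos-+ a a)) (sym (ℤP.pos-+ b c))) (sym (+[m∸n]≡+m-+n b+c≤2a)))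

∣⇒%ℕ≡0 : ∀ a d .{{_ : ℕ.NonZero d}} → d ℕD.∣ ℤ.∣ a ∣ → a %ℕ d ≡ 0
∣⇒%ℕ≡0 (+ m) d d∣m = ℕD.n∣m⇒m%n≡0 m d d∣m
∣⇒%ℕ≡0 -[1+ m ] d d∣m with ℕ._%_ (suc m) d | ℕD.n∣m⇒m%n≡0 (suc m) d d∣m
... | .0 | refl = refl

∣⇒≡[/ℕ]* : ∀ a d .{{_ : ℕ.NonZero d}} → d ℕD.∣ ℤ.∣ a ∣ → a ≡ (a /ℕ d) * + d
∣⇒≡[/ℕ]* a d d∣a =
  trans (a≡a%ℕn+[a/ℕn]*n a d) (trans (cong (λ m → + m + (a /ℕ d) * + d) (∣⇒%ℕ≡0 a d d∣a)) (ℤP.+-identityˡ _))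

kink≥1 : ∀ t σ → σ ≢ + 0 → + 1 ≤ (t - (t - σ) ⊓ t) + (t - (t + σ) ⊓ t)
kink≥1 t (+ zero) σ≢0 = contradiction refl σ≢0
kink≥1 t (+ suc k) _
  rewrite ℤP.i≤j⇒i⊓j≡i (ℤP.i-j≤i t (+ suc k)) | ℤP.i≥j⇒i⊓j≡j (ℤP.i≤i+j t (+ suc k)) =
  subst (+ 1 ≤_) (sym (rise t (+ suc k))) (ℤ.+≤+ (s≤s z≤n))
  where
    rise : ∀ t s → (t - (t - s)) + (t - t) ≡ s
    rise = solve-∀
kink≥1 t -[1+ k ] _
  rewrite ℤP.i≥j⇒i⊓j≡j (ℤP.i≤i+j t (+ suc k)) | ℤP.i≤j⇒i⊓j≡i (ℤP.i-j≤i t (+ suc k)) =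
  subst (+ 1 ≤_) (sym (fall t (+ suc k))) (ℤ.+≤+ (s≤s z≤n))
  where
    fall : ∀ t s → (t - t) + (t - (t - s)) ≡ s
    fall = solve-∀

module Tent (L p : ℕ) (0<p : 0 ℕ.< p) (p<L : p ℕ.< L) where

  -- Capping the tent at min(p, L − p) puts one of its corners at p.
  height : ℕ
  height = p ℕ.⊓ (L ℕ.∸ p)

  tent : ℕ → ℕ
  tent q = q ℕ.⊓ (L ℕ.∸ q) ℕ.⊓ height

  tent≤id : ∀ q → tent q ℕ.≤ q
  tent≤id q = ℕP.≤-trans (ℕP.m⊓n≤m _ height) (ℕP.m⊓n≤m q _)

  tent≤L∸id : ∀ q → tent q ℕ.≤ L ℕ.∸ q
  tent≤L∸id q = ℕP.≤-trans (ℕP.m⊓n≤m _ height) (ℕP.m⊓n≤n q _)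

  tent≤height : ∀ q → tent q ℕ.≤ height
  tent≤height q = ℕP.m⊓n≤n _ height

  1≤height : 1 ℕ.≤ height
  1≤height = ℕP.⊓-glb 0<p (ℕP.m<n⇒0<n∸m p<L)

  L∸q≡1+L∸[1+q] : ∀ {q} → q ℕ.< L → L ℕ.∸ q ≡ suc (L ℕ.∸ suc q)
  L∸q≡1+L∸[1+q] q<L = ℕP.+-∸-assoc 1 q<L

  -- tent q is one of q, L − q and height; that affine function bounds tent at q ± 1.
  tent-concave : ∀ q → 0 ℕ.< q → q ℕ.< L → tent (suc q) ℕ.+ tent (q ℕ.∸ 1) ℕ.≤ tent q ℕ.+ tent q
  tent-concave (suc q′) _ q<L = by-cases (ℕP.⊓-sel (q ℕ.⊓ (L ℕ.∸ q)) height) (ℕP.⊓-sel q (L ℕ.∸ q))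
    where
      q neighbours a : ℕ
      q = suc q′
      neighbours = tent (suc q) ℕ.+ tent q′
      a = L ℕ.∸ suc q
      ≤2q : neighbours ℕ.≤ q ℕ.+ q
      ≤2q = subst (neighbours ℕ.≤_) (trans (ℕP.+-comm (suc q) q′) (ℕP.+-suc q′ q))
              (ℕP.+-mono-≤ (tent≤id (suc q)) (tent≤id q′))
      ≤2[L∸q] : neighbours ℕ.≤ (L ℕ.∸ q) ℕ.+ (L ℕ.∸ q)
      ≤2[L∸q] = subst (neighbours ℕ.≤_)
        (trans (ℕP.+-comm a (suc (suc a))) (trans (cong suc (sym (ℕP.+-suc a a)))
          (sym (cong₂ ℕ._+_ (L∸q≡1+L∸[1+q] q<L) (L∸q≡1+L∸[1+q] q<L)))))
        (ℕP.+-mono-≤ (tent≤L∸id (suc q))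
          (subst (tent q′ ℕ.≤_)
            (trans (L∸q≡1+L∸[1+q] (ℕP.<-trans (ℕP.n<1+n q′) q<L)) (cong suc (L∸q≡1+L∸[1+q] q<L)))
            (tent≤L∸id q′)))
      ≤2height : neighbours ℕ.≤ height ℕ.+ height
      ≤2height = ℕP.+-mono-≤ (tent≤height (suc q)) (tent≤height q′)
      by-cases : tent q ≡ q ℕ.⊓ (L ℕ.∸ q) ⊎ tent q ≡ height →
        q ℕ.⊓ (L ℕ.∸ q) ≡ q ⊎ q ℕ.⊓ (L ℕ.∸ q) ≡ L ℕ.∸ q → neighbours ℕ.≤ tent q ℕ.+ tent q
      by-cases (inj₂ ≡height) _ = subst (λ z → neighbours ℕ.≤ z ℕ.+ z) (sym ≡height) ≤2height
      by-cases (inj₁ ≡min) (inj₁ ≡q) = subst (λ z → neighbours ℕ.≤ z ℕ.+ z) (sym (trans ≡min ≡q)) ≤2q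
      by-cases (inj₁ ≡min) (inj₂ ≡L∸q) = subst (λ z → neighbours ℕ.≤ z ℕ.+ z) (sym (trans ≡min ≡L∸q)) ≤2[L∸q]

  tent-peak : tent (suc p) ℕ.+ tent (p ℕ.∸ 1) ℕ.+ 1 ℕ.≤ tent p ℕ.+ tent p
  tent-peak = subst (λ z → tent (suc p) ℕ.+ tent (p ℕ.∸ 1) ℕ.+ 1 ℕ.≤ z ℕ.+ z) (sym (ℕP.⊓-idem height))
    (by-cases (ℕP.⊓-sel p (L ℕ.∸ p)))
    where
      by-cases : height ≡ p ⊎ height ≡ L ℕ.∸ p → tent (suc p) ℕ.+ tent (p ℕ.∸ 1) ℕ.+ 1 ℕ.≤ height ℕ.+ height
      by-cases (inj₁ ≡p) = ℕP.≤-trans (ℕP.+-monoˡ-≤ 1 (ℕP.+-mono-≤ (tent≤height (suc p)) (tent≤id (p ℕ.∸ 1))))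
        (ℕP.≤-reflexive (trans (ℕP.+-assoc height (p ℕ.∸ 1) 1)
          (cong (height ℕ.+_) (trans (ℕP.m∸n+n≡m 0<p) (sym ≡p)))))
      by-cases (inj₂ ≡L∸p) = ℕP.≤-trans (ℕP.+-monoˡ-≤ 1 (ℕP.+-mono-≤ (tent≤L∸id (suc p)) (tent≤height (p ℕ.∸ 1))))
        (ℕP.≤-reflexive (trans (ℕP.+-comm (L ℕ.∸ suc p ℕ.+ height) 1)
          (cong (ℕ._+ height) (trans (sym (L∸q≡1+L∸[1+q] p<L)) (sym ≡L∸p)))))

  tent-L : tent L ≡ 0
  tent-L = trans (cong (λ z → L ℕ.⊓ z ℕ.⊓ height) (ℕP.n∸n≡0 L)) (cong (ℕ._⊓ height) (ℕP.⊓-zeroʳ L))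

  tent-1 : tent 1 ≡ 1
  tent-1 = trans (cong (ℕ._⊓ height) (ℕP.m≤n⇒m⊓n≡m (ℕP.m<n⇒0<n∸m 1<L))) (ℕP.m≤n⇒m⊓n≡m 1≤height)
    where
      1<L : 1 ℕ.< L
      1<L = ℕP.≤-<-trans 0<p p<L

  tent-L∸1 : tent (L ℕ.∸ 1) ≡ 1
  tent-L∸1 = trans (cong (λ z → (L ℕ.∸ 1) ℕ.⊓ z ℕ.⊓ height) (ℕP.m∸[m∸n]≡n (ℕP.<-trans 0<p p<L)))
    (trans (cong (ℕ._⊓ height) (ℕP.m≥n⇒m⊓n≡n (ℕP.m<n⇒0<n∸m 1<L))) (ℕP.m≤n⇒m⊓n≡m 1≤height))
    where
      1<L : 1 ℕ.< L
      1<L = ℕP.≤-<-trans 0<p p<L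

-- Finite sums

sumℤ : List ℤ → ℤ
sumℤ = foldr _+_ (+ 0)

module _ {A : Set} where

  sum-cong : ∀ {f g : A → ℤ} xs → (∀ x → f x ≡ g x) → sumℤ (map f xs) ≡ sumℤ (map g xs)
  sum-cong xs f≗g = cong sumℤ (LP.map-cong f≗g xs)

  sum-++ : ∀ (xs ys : List ℤ) → sumℤ (xs ++ ys) ≡ sumℤ xs + sumℤ ys
  sum-++ [] ys = sym (ℤP.+-identityˡ _)
  sum-++ (x ∷ xs) ys = trans (cong (λ s → x + s) (sum-++ xs ys)) (sym (ℤP.+-assoc x _ _))

  sum-concatMap : ∀ {B : Set} (f : B → ℤ) (g : A → List B) xs →
    sumℤ (map f (concatMap g xs)) ≡ sumℤ (map (λ x → sumℤ (map f (g x))) xs)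
  sum-concatMap f g [] = refl
  sum-concatMap f g (x ∷ xs) = begin
    sumℤ (map f (g x ++ concatMap g xs))
      ≡⟨ cong sumℤ (LP.map-++ f (g x) (concatMap g xs)) ⟩
    sumℤ (map f (g x) ++ map f (concatMap g xs))
      ≡⟨ sum-++ (map f (g x)) _ ⟩
    sumℤ (map f (g x)) + sumℤ (map f (concatMap g xs))
      ≡⟨ cong (λ s → sumℤ (map f (g x)) + s) (sum-concatMap f g xs) ⟩
    sumℤ (map (λ x → sumℤ (map f (g x))) (x ∷ xs)) ∎
    where open ≡-Reasoning

  sum-+ : ∀ (f g : A → ℤ) xs → sumℤ (map (λ x → f x + g x) xs) ≡ sumℤ (map f xs) + sumℤ (map g xs)
  sum-+ f g [] = refl
  sum-+ f g (x ∷ xs) = trans (cong (λ s → f x + g x + s) (sum-+ f g xs)) (interchange (f x) (g x) _ _)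
    where
      interchange : ∀ a b c d → (a + b) + (c + d) ≡ (a + c) + (b + d)
      interchange = solve-∀

  sum-neg : ∀ (f : A → ℤ) xs → sumℤ (map (λ x → - f x) xs) ≡ - sumℤ (map f xs)
  sum-neg f [] = refl
  sum-neg f (x ∷ xs) = trans (cong (λ s → - f x + s) (sum-neg f xs)) (sym (ℤP.neg-distrib-+ (f x) _))

  sum-zero : ∀ (f : A → ℤ) xs → (∀ x → f x ≡ + 0) → sumℤ (map f xs) ≡ + 0
  sum-zero f [] f≡0 = refl
  sum-zero f (x ∷ xs) f≡0 = cong₂ _+_ (f≡0 x) (sum-zero f xs f≡0)

  sum-mono-≤ : ∀ {f g : A → ℤ} xs → (∀ x → f x ≤ g x) → sumℤ (map f xs) ≤ sumℤ (map g xs)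
  sum-mono-≤ [] f≤g = ℤP.≤-refl
  sum-mono-≤ (x ∷ xs) f≤g = ℤP.+-mono-≤ (f≤g x) (sum-mono-≤ xs f≤g)

  sum-nonneg : ∀ (f : A → ℤ) xs → (∀ x → x ∈ xs → + 0 ≤ f x) → + 0 ≤ sumℤ (map f xs)
  sum-nonneg f [] f≥0 = ℤP.≤-refl
  sum-nonneg f (x ∷ xs) f≥0 = ℤP.+-mono-≤ (f≥0 x (here refl)) (sum-nonneg f xs (λ y y∈ → f≥0 y (there y∈)))

  summand≤sum : ∀ (f : A → ℤ) xs → (∀ x → x ∈ xs → + 0 ≤ f x) → ∀ x → x ∈ xs → f x ≤ sumℤ (map f xs)
  summand≤sum f (y ∷ xs) f≥0 x (here refl) =
    ℤP.i≤i+j (f x) _ {{ℤ.nonNegative (sum-nonneg f xs (λ z z∈ → f≥0 z (there z∈)))}}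
  summand≤sum f (y ∷ xs) f≥0 x (there x∈) =
    ℤP.≤-trans (summand≤sum f xs (λ z z∈ → f≥0 z (there z∈)) x x∈) (ℤP.i≤j+i _ _ {{ℤ.nonNegative (f≥0 y (here refl))}})

  positive-summand : ∀ (f : A → ℤ) xs → + 1 ≤ sumℤ (map f xs) → ∃ λ x → x ∈ xs × + 1 ≤ f x
  positive-summand f [] (ℤ.+≤+ ())
  positive-summand f (x ∷ xs) 1≤sum with f x ℤP.≤? + 0
  ... | no fx≰0 = x , here refl , ℤP.i<j⇒suc[i]≤j (ℤP.≰⇒> fx≰0)
  ... | yes fx≤0
    with positive-summand f xs (ℤP.≤-trans 1≤sum (ℤP.≤-trans (ℤP.+-monoˡ-≤ _ fx≤0) (ℤP.≤-reflexive (ℤP.+-identityˡ _))))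
  ...   | y , y∈ , 1≤fy = y , there y∈ , 1≤fy

sumBelow : (ℕ → ℤ) → ℕ → ℤ
sumBelow f zero = + 0
sumBelow f (suc N) = f 0 + sumBelow (f ∘ suc) N

sum-applyUpTo : ∀ (f : ℕ → ℤ) (g : ℕ → ℕ) N → sumℤ (map f (applyUpTo g N)) ≡ sumBelow (f ∘ g) N
sum-applyUpTo f g zero = refl
sum-applyUpTo f g (suc N) = cong (λ s → f (g 0) + s) (sum-applyUpTo f (g ∘ suc) N)

sumBelow-zero : ∀ f N → (∀ j → j ℕ.< N → f j ≡ + 0) → sumBelow f N ≡ + 0
sumBelow-zero f zero f≡0 = refl
sumBelow-zero f (suc N) f≡0 =
  cong₂ _+_ (f≡0 0 (s≤s z≤n)) (sumBelow-zero (f ∘ suc) N (λ j j<N → f≡0 (suc j) (s≤s j<N)))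

sumBelow-single : ∀ f N k → k ℕ.< N → (∀ j → j ℕ.< N → j ≢ k → f j ≡ + 0) → sumBelow f N ≡ f k
sumBelow-single f (suc N) zero _ f≡0 =
  trans (cong (λ s → f 0 + s) (sumBelow-zero (f ∘ suc) N (λ j j<N → f≡0 (suc j) (s≤s j<N) (λ ())))) (ℤP.+-identityʳ _)
sumBelow-single f (suc N) (suc k) (s≤s k<N) f≡0 =
  trans (cong (_+ sumBelow (f ∘ suc) N) (f≡0 0 (s≤s z≤n) (λ ())))
        (trans (ℤP.+-identityˡ _)
               (sumBelow-single (f ∘ suc) N k k<N (λ j j<N j≢k → f≡0 (suc j) (s≤s j<N) (j≢k ∘ ℕP.suc-injective))))

sum-allFin-single : ∀ {n} (f : Fin n → ℤ) a → (∀ x → x ≢ a → f x ≡ + 0) → sumℤ (map f (allFin n)) ≡ f a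
sum-allFin-single {suc n} f a f≡0 = trans (cong (λ xs → sumℤ (map f xs)) allFin-suc) (split a f≡0)
  where
    allFin-suc : allFin (suc n) ≡ Fin.zero ∷ map Fin.suc (allFin n)
    allFin-suc = cong (Fin.zero ∷_) (sym (LP.map-tabulate id Fin.suc))
    tail≡ : sumℤ (map f (map Fin.suc (allFin n))) ≡ sumℤ (map (f ∘ Fin.suc) (allFin n))
    tail≡ = cong sumℤ (sym (LP.map-∘ (allFin n)))
    split : ∀ a → (∀ x → x ≢ a → f x ≡ + 0) → f Fin.zero + sumℤ (map f (map Fin.suc (allFin n))) ≡ f a
    split Fin.zero f≡0 =
      trans (cong (λ s → f Fin.zero + s)
                  (trans tail≡ (sum-zero (f ∘ Fin.suc) (allFin n) (λ x → f≡0 (Fin.suc x) (λ ())))))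
            (ℤP.+-identityʳ _)
    split (Fin.suc a) f≡0 =
      trans (cong₂ _+_ (f≡0 Fin.zero (λ ()))
                       (trans tail≡ (sum-allFin-single (f ∘ Fin.suc) a
                                      (λ x x≢a → f≡0 (Fin.suc x) (x≢a ∘ FP.suc-injective)))))
            (ℤP.+-identityˡ _)

sum-allFin-pair : ∀ {n} (f : Fin n → ℤ) a b → a ≢ b → (∀ x → x ≢ a → x ≢ b → f x ≡ + 0) →
  sumℤ (map f (allFin n)) ≡ f a + f b
sum-allFin-pair {n} f a b a≢b f≡0 = begin
  sumℤ (map f (allFin n))                   ≡⟨ sum-cong (allFin n) split ⟩
  sumℤ (map (λ x → at-a x + off-a x) (allFin n)) ≡⟨ sum-+ at-a off-a (allFin n) ⟩
  sumℤ (map at-a (allFin n)) + sumℤ (map off-a (allFin n))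
    ≡⟨ cong₂ _+_ (sum-allFin-single at-a a at-a≡0) (sum-allFin-single off-a b off-a≡0) ⟩
  at-a a + off-a b                          ≡⟨ cong₂ _+_ at-a-a off-a-b ⟩
  f a + f b ∎
  where
    open ≡-Reasoning
    at-a off-a : Fin n → ℤ
    at-a x = if does (x FP.≟ a) then f x else + 0
    off-a x = if does (x FP.≟ a) then + 0 else f x
    split : ∀ x → f x ≡ at-a x + off-a x
    split x with x FP.≟ a
    ... | yes _ = sym (ℤP.+-identityʳ _)
    ... | no _ = sym (ℤP.+-identityˡ _)
    at-a≡0 : ∀ x → x ≢ a → at-a x ≡ + 0
    at-a≡0 x x≢a rewrite dec-false (x FP.≟ a) x≢a = refl
    off-a≡0 : ∀ x → x ≢ b → off-a x ≡ + 0
    off-a≡0 x x≢b with x FP.≟ a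
    ... | yes _ = refl
    ... | no x≢a = f≡0 x x≢a x≢b
    at-a-a : at-a a ≡ f a
    at-a-a rewrite dec-true (a FP.≟ a) refl = refl
    off-a-b : off-a b ≡ f b
    off-a-b rewrite dec-false (b FP.≟ a) (a≢b ∘ sym) = refl

-- The unit-length Laplacian

module _ {X : Set} where

  infixl 6 _⊕_ _⊖_
  infixl 7 _⊓ᶜ_

  _⊕_ _⊖_ : (X → ℤ) → (X → ℤ) → X → ℤ
  (φ ⊕ ψ) x = φ x + ψ x
  (φ ⊖ ψ) x = φ x - ψ x

  _⊓ᶜ_ : (X → ℤ) → ℤ → X → ℤ
  (φ ⊓ᶜ t) x = φ x ⊓ t

module UnitLaplacian (G : RawGraph) where
  open RawGraph G

  Δ₁ : (X → ℤ) → X → ℤ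
  Δ₁ = Δ G (unitLength G)

  outflow : (X → ℤ) → X → X → ℤ
  outflow φ y z = if not (isVertex G z) ∧ does (r z ≟ y) then φ y - φ (r (i z)) else + 0

  Δ₁≡Σoutflow : ∀ φ y → Δ₁ φ y ≡ ΣX G (outflow φ y)
  Δ₁≡Σoutflow φ y = sum-cong elems quot-by-1
    where
      quot-by-1 : ∀ z → (if not (isVertex G z) ∧ does (r z ≟ y)
                           then quot G (φ y - φ (r (i z))) (unitLength G z) else + 0) ≡ outflow φ y z
      quot-by-1 z with isVertex G z
      ... | true = refl
      ... | false with does (r z ≟ y)
      ...   | true = sym (trans (∣⇒≡[/ℕ]* _ 1 (ℕD.1∣ _)) (ℤP.*-identityʳ _))
      ...   | false = refl

  outflow-vanishes : ∀ φ y z → isVertex G z ≡ true ⊎ r z ≢ y → outflow φ y z ≡ + 0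
  outflow-vanishes φ y z (inj₁ z-vertex) rewrite z-vertex = refl
  outflow-vanishes φ y z (inj₂ rz≢y) with isVertex G z
  ... | true = refl
  ... | false rewrite dec-false (r z ≟ y) rz≢y = refl

  outflow-along : ∀ φ y z → isVertex G z ≡ false → r z ≡ y → outflow φ y z ≡ φ y - φ (r (i z))
  outflow-along φ y z z-edge rz≡y rewrite z-edge | dec-true (r z ≟ y) rz≡y = refl

  Δ₁-⊕ : ∀ φ ψ y → Δ₁ (φ ⊕ ψ) y ≡ Δ₁ φ y + Δ₁ ψ y
  Δ₁-⊕ φ ψ y = begin
    Δ₁ (φ ⊕ ψ) y                                    ≡⟨ Δ₁≡Σoutflow (φ ⊕ ψ) y ⟩
    ΣX G (outflow (φ ⊕ ψ) y)                        ≡⟨ sum-cong elems split ⟩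
    sumℤ (map (λ z → outflow φ y z + outflow ψ y z) elems) ≡⟨ sum-+ (outflow φ y) (outflow ψ y) elems ⟩
    ΣX G (outflow φ y) + ΣX G (outflow ψ y)         ≡⟨ sym (cong₂ _+_ (Δ₁≡Σoutflow φ y) (Δ₁≡Σoutflow ψ y)) ⟩
    Δ₁ φ y + Δ₁ ψ y ∎
    where
      open ≡-Reasoning
      regroup : ∀ a b c d → (a + b) - (c + d) ≡ (a - c) + (b - d)
      regroup = solve-∀
      split : ∀ z → outflow (φ ⊕ ψ) y z ≡ outflow φ y z + outflow ψ y z
      split z with not (isVertex G z) ∧ does (r z ≟ y)
      ... | true = regroup (φ y) (ψ y) (φ (r (i z))) (ψ (r (i z)))
      ... | false = refl

  Δ₁-⊖ : ∀ φ ψ y → Δ₁ (φ ⊖ ψ) y ≡ Δ₁ φ y - Δ₁ ψ y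
  Δ₁-⊖ φ ψ y = begin
    Δ₁ (φ ⊖ ψ) y                                      ≡⟨ Δ₁≡Σoutflow (φ ⊖ ψ) y ⟩
    ΣX G (outflow (φ ⊖ ψ) y)                          ≡⟨ sum-cong elems split ⟩
    sumℤ (map (λ z → outflow φ y z + - outflow ψ y z) elems) ≡⟨ sum-+ (outflow φ y) (λ z → - outflow ψ y z) elems ⟩
    ΣX G (outflow φ y) + sumℤ (map (λ z → - outflow ψ y z) elems)
      ≡⟨ cong (λ s → ΣX G (outflow φ y) + s) (sum-neg (outflow ψ y) elems) ⟩
    ΣX G (outflow φ y) - ΣX G (outflow ψ y)           ≡⟨ sym (cong₂ _-_ (Δ₁≡Σoutflow φ y) (Δ₁≡Σoutflow ψ y)) ⟩
    Δ₁ φ y - Δ₁ ψ y ∎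
    where
      open ≡-Reasoning
      regroup : ∀ a b c d → (a - b) - (c - d) ≡ (a - c) + - (b - d)
      regroup = solve-∀
      split : ∀ z → outflow (φ ⊖ ψ) y z ≡ outflow φ y z + - outflow ψ y z
      split z with not (isVertex G z) ∧ does (r z ≟ y)
      ... | true = regroup (φ y) (ψ y) (φ (r (i z))) (ψ (r (i z)))
      ... | false = refl

  Δ₁-mono-⊓ᶜ : ∀ φ t y → φ y ≤ t → Δ₁ φ y ≤ Δ₁ (φ ⊓ᶜ t) y
  Δ₁-mono-⊓ᶜ φ t y φy≤t rewrite Δ₁≡Σoutflow φ y | Δ₁≡Σoutflow (φ ⊓ᶜ t) y = sum-mono-≤ elems termwise
    where
      termwise : ∀ z → outflow φ y z ≤ outflow (φ ⊓ᶜ t) y z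
      termwise z with not (isVertex G z) ∧ does (r z ≟ y)
      ... | true rewrite ℤP.i≤j⇒i⊓j≡i φy≤t =
        ℤP.+-monoʳ-≤ (φ y) (ℤP.neg-mono-≤ (ℤP.i⊓j≤i (φ (r (i z))) t))
      ... | false = ℤP.≤-refl

  Δ₁-⊓ᶜ-nonneg : ∀ φ t y → t ≤ φ y → + 0 ≤ Δ₁ (φ ⊓ᶜ t) y
  Δ₁-⊓ᶜ-nonneg φ t y t≤φy rewrite Δ₁≡Σoutflow (φ ⊓ᶜ t) y = sum-nonneg _ elems (λ z _ → termwise z)
    where
      termwise : ∀ z → + 0 ≤ outflow (φ ⊓ᶜ t) y z
      termwise z with not (isVertex G z) ∧ does (r z ≟ y)
      ... | true rewrite ℤP.i≥j⇒i⊓j≡j t≤φy = ℤP.i≤j⇒0≤j-i (ℤP.i⊓j≤j (φ (r (i z))) t)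
      ... | false = ℤP.≤-refl

  Δ₁-min-≥ˡ : ∀ φ₁ φ₂ t y → (φ₁ ⊖ φ₂) y ≤ t → Δ₁ φ₁ y ≤ Δ₁ (φ₂ ⊕ (φ₁ ⊖ φ₂) ⊓ᶜ t) y
  Δ₁-min-≥ˡ φ₁ φ₂ t y Φy≤t = begin
    Δ₁ φ₁ y                             ≡⟨ sym (cancel (Δ₁ φ₂ y) (Δ₁ φ₁ y)) ⟩
    Δ₁ φ₂ y + (Δ₁ φ₁ y - Δ₁ φ₂ y)       ≡⟨ cong (λ s → Δ₁ φ₂ y + s) (sym (Δ₁-⊖ φ₁ φ₂ y)) ⟩
    Δ₁ φ₂ y + Δ₁ (φ₁ ⊖ φ₂) y             ≤⟨ ℤP.+-monoʳ-≤ (Δ₁ φ₂ y) (Δ₁-mono-⊓ᶜ (φ₁ ⊖ φ₂) t y Φy≤t) ⟩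
    Δ₁ φ₂ y + Δ₁ ((φ₁ ⊖ φ₂) ⊓ᶜ t) y      ≡⟨ sym (Δ₁-⊕ φ₂ ((φ₁ ⊖ φ₂) ⊓ᶜ t) y) ⟩
    Δ₁ (φ₂ ⊕ (φ₁ ⊖ φ₂) ⊓ᶜ t) y ∎
    where
      open ℤP.≤-Reasoning
      cancel : ∀ a b → a + (b - a) ≡ b
      cancel = solve-∀

  Δ₁-min-≥ʳ : ∀ φ₁ φ₂ t y → t ≤ (φ₁ ⊖ φ₂) y → Δ₁ φ₂ y ≤ Δ₁ (φ₂ ⊕ (φ₁ ⊖ φ₂) ⊓ᶜ t) y
  Δ₁-min-≥ʳ φ₁ φ₂ t y t≤Φy = subst (Δ₁ φ₂ y ≤_) (sym (Δ₁-⊕ φ₂ ((φ₁ ⊖ φ₂) ⊓ᶜ t) y))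
    (ℤP.i≤i+j _ _ {{ℤ.nonNegative (Δ₁-⊓ᶜ-nonneg (φ₁ ⊖ φ₂) t y t≤Φy)}})

  chip : X → X → ℤ
  chip w y = if does (y ≟ w) then + 1 else + 0

  Δ₁-off-vertices : (∀ z → r (r z) ≡ r z) → ∀ φ y → isVertex G y ≡ false → Δ₁ φ y ≡ + 0
  Δ₁-off-vertices r-idem φ y y-edge = trans (Δ₁≡Σoutflow φ y) (sum-zero _ elems termwise)
    where
      termwise : ∀ z → outflow φ y z ≡ + 0
      termwise z = outflow-vanishes φ y z (inj₂ λ rz≡y →
        contradiction (trans (sym y-edge) (dec-true (r y ≟ y) (trans (cong r (sym rz≡y)) (trans (r-idem z) rz≡y)))) λ ())

  unit-PL : (∀ x → r x ≡ x → i x ≡ x) → ∀ g → IsPL G (unitLength G) g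
  unit-PL i-vertex g e _ with r e ≟ e
  ... | no _ = ℕD.1∣ _
  ... | yes re≡e rewrite i-vertex e re≡e | re≡e | ℤP.+-inverseʳ (g e) = ℕD.∣-refl

  Vertex-Effective : (X → ℤ) → Set
  Vertex-Effective E = ∀ y → y ∈ elems → r y ≡ y → + 0 ≤ E y

  chip-removable : ∀ {P : X → Set} (A : X → ℤ) w → (∀ y → P y → + 0 ≤ A y) → + 1 ≤ A w →
    ∀ y → P y → + 0 ≤ A y - chip w y
  chip-removable A w A≥0 1≤Aw y Py with y ≟ w
  ... | yes refl = ℤP.i≤j⇒0≤j-i 1≤Aw
  ... | no _ = subst (+ 0 ≤_) (sym (ℤP.+-identityʳ (A y))) (A≥0 y Py)

  degree-one-is-chip : ∀ F → Effective G F → deg G F ≡ + 1 →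
    ∃ λ w → w ∈ elems × r w ≡ w × (∀ y → y ∈ elems → r y ≡ y → F y ≡ chip w y)
  degree-one-is-chip F F≥0 degF≡1
    with positive-summand (λ y → if isVertex G y then F y else + 0) elems (ℤP.≤-reflexive (sym degF≡1))
  ... | w , w∈ , 1≤Fw with r w ≟ w
  ...   | no _ = contradiction 1≤Fw λ { (ℤ.+≤+ ()) }
  ...   | yes w-vertex = w , w∈ , w-vertex , F≡chip
    where
      onVertices : (X → ℤ) → X → ℤ
      onVertices f y = if isVertex G y then f y else + 0
      excess : X → ℤ
      excess y = onVertices F y - onVertices (chip w) y
      excess≥0 : ∀ y → y ∈ elems → + 0 ≤ excess y
      excess≥0 y y∈ with isVertex G y | y ≟ w
      ... | false | _ = ℤP.≤-refl
      ... | true | yes refl = ℤP.i≤j⇒0≤j-i 1≤Fw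
      ... | true | no _ = subst (+ 0 ≤_) (sym (ℤP.+-identityʳ (F y))) (F≥0 y y∈)
      chip-on-vertices≥0 : ∀ y → y ∈ elems → + 0 ≤ onVertices (chip w) y
      chip-on-vertices≥0 y _ with isVertex G y | does (y ≟ w)
      ... | false | _ = ℤP.≤-refl
      ... | true | true = ℤ.+≤+ z≤n
      ... | true | false = ℤP.≤-refl
      chip-at-w : onVertices (chip w) w ≡ + 1
      chip-at-w rewrite dec-true (r w ≟ w) w-vertex | dec-true (w ≟ w) refl = refl
      Σexcess≤0 : sumℤ (map excess elems) ≤ + 0
      Σexcess≤0 = begin
        sumℤ (map excess elems)
          ≡⟨ sum-+ (onVertices F) (λ y → - onVertices (chip w) y) elems ⟩
        deg G F + sumℤ (map (λ y → - onVertices (chip w) y) elems)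
          ≡⟨ cong₂ (λ a b → a + b) degF≡1 (sum-neg (onVertices (chip w)) elems) ⟩
        + 1 - sumℤ (map (onVertices (chip w)) elems)
          ≤⟨ ℤP.i≤j⇒i-j≤0 (subst (_≤ sumℤ (map (onVertices (chip w)) elems)) chip-at-w
                            (summand≤sum (onVertices (chip w)) elems chip-on-vertices≥0 w w∈)) ⟩
        + 0 ∎
        where open ℤP.≤-Reasoning
      F≡chip : ∀ y → y ∈ elems → r y ≡ y → F y ≡ chip w y
      F≡chip y y∈ y-vertex = ℤP.i-j≡0⇒i≡j (F y) (chip w y)
        (subst (λ b → (if b then F y else + 0) - (if b then chip w y else + 0) ≡ + 0) (dec-true (r y ≟ y) y-vertex)
          (ℤP.≤-antisym (ℤP.≤-trans (summand≤sum excess elems excess≥0 y y∈) Σexcess≤0) (excess≥0 y y∈)))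

  rank≥1-if-chips-removable : (∀ z → r (r z) ≡ r z) → (∀ x → r x ≡ x → i x ≡ x) →
    ∀ D → IsDivisor G D →
    (∀ w → w ∈ elems → r w ≡ w → ∃ λ g → Vertex-Effective (D ⊕ Δ₁ g ⊖ chip w)) →
    RankGeq G (unitLength G) D 1
  rank≥1-if-chips-removable r-idem i-vertex D D-div remove =
    1 , ℕP.≤-refl , λ F F-div F≥0 degF≡1 → linearSystem F F-div (degree-one-is-chip F F≥0 degF≡1)
    where
      linearSystem : ∀ F → IsDivisor G F →
        (∃ λ w → w ∈ elems × r w ≡ w × (∀ y → y ∈ elems → r y ≡ y → F y ≡ chip w y)) →
        LinSysNonempty G (unitLength G) (D ⊖ F)
      linearSystem F F-div (w , w∈ , w-vertex , F≡chip) with remove w w∈ w-vertex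
      ... | g , E≥0 = E , E-div , E≥0′ , g , unit-PL i-vertex g , E∼D-F
        where
          E : X → ℤ
          E y = if isVertex G y then (D ⊕ Δ₁ g ⊖ F) y else + 0
          E-div : IsDivisor G E
          E-div y _ y-edge rewrite dec-false (r y ≟ y) y-edge = refl
          E≥0′ : Effective G E
          E≥0′ y y∈ with r y ≟ y
          ... | yes y-vertex rewrite F≡chip y y∈ y-vertex = E≥0 y y∈ y-vertex
          ... | no _ = ℤP.≤-refl
          cancel : ∀ a b c → (a + c - b) - (a - b) ≡ c
          cancel = solve-∀
          E∼D-F : ∀ y → y ∈ elems → E y - (D y - F y) ≡ Δ₁ g y
          E∼D-F y y∈ with r y ≟ y
          ... | yes _ = cancel (D y) (F y) (Δ₁ g y)
          ... | no y-edge rewrite D-div y y∈ y-edge | F-div y y∈ y-edge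
                                | Δ₁-off-vertices r-idem g y (dec-false (r y ≟ y) y-edge) = refl

-- The subdivided graph

record LooplessMetricGraph (n : ℕ) (r i : Fin n → Fin n) (l : Fin n → ℕ) : Set where
  field
    r-idem          : ∀ x → r (r x) ≡ r x
    i-invol         : ∀ x → i (i x) ≡ x
    i-fixed⇒vertex  : ∀ x → i x ≡ x → r x ≡ x
    vertex⇒i-fixed  : ∀ x → r x ≡ x → i x ≡ x
    l-i             : ∀ x → l (i x) ≡ l x
    l≡0⇒vertex      : ∀ x → l x ≡ 0 → r x ≡ x
    no-loop         : ∀ e → r e ≢ e → r e ≢ r (i e)

data Position (L : ℕ) : ℕ → Set where
  start    : Position L 0
  end      : Position L L
  interior : ∀ {q} → 0 ℕ.< q → q ℕ.< L → Position L q

position : ∀ {L} q → q ℕ.≤ L → Position L q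
position zero _ = start
position {L} (suc q) q<L with suc q ℕ.≟ L
... | yes refl = end
... | no q≢L = interior (s≤s z≤n) (ℕP.≤∧≢⇒< q<L q≢L)

module Subdivided {n : ℕ} {r i : Fin n → Fin n} {l : Fin n → ℕ} (axioms : LooplessMetricGraph n r i l) where
  open LooplessMetricGraph axioms
  open Subdivision n r i l public
  open UnitLaplacian graph public

  Point : Set
  Point = Fin n × ℕ

  _≟H_ : (y z : Point) → Dec (y ≡ z)
  _≟H_ = RawGraph._≟_ graph

  IsEdge : Fin n → Set
  IsEdge x = isV x ≡ false

  edge⇒r≢ : ∀ {x} → IsEdge x → r x ≢ x
  edge⇒r≢ {x} x-edge rx≡x = contradiction (trans (sym (dec-true (r x FP.≟ x) rx≡x)) x-edge) λ ()

  isV⇒r≡ : ∀ {x} → isV x ≡ true → r x ≡ x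
  isV⇒r≡ {x} x-vertex with r x FP.≟ x
  ... | yes rx≡x = rx≡x

  isV-r : ∀ x → isV (r x) ≡ true
  isV-r x = dec-true (r (r x) FP.≟ r x) (r-idem x)

  edge⇒i≢ : ∀ {e} → IsEdge e → i e ≢ e
  edge⇒i≢ e-edge = edge⇒r≢ e-edge ∘ i-fixed⇒vertex _

  edge-i : ∀ {e} → IsEdge e → IsEdge (i e)
  edge-i {e} e-edge = dec-false (r (i e) FP.≟ i e) λ rie≡ie →
    edge⇒i≢ e-edge (trans (sym (vertex⇒i-fixed _ rie≡ie)) (i-invol e))

  edge⇒1≤l : ∀ {e} → IsEdge e → 1 ℕ.≤ l e
  edge⇒1≤l {e} e-edge with l e in le≡
  ... | zero = contradiction (l≡0⇒vertex e le≡) (edge⇒r≢ e-edge)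
  ... | suc _ = s≤s z≤n

  own-i : ∀ {e} → IsEdge e → own (i e) ≡ not (own e)
  own-i {e} e-edge rewrite i-invol e with toℕ e ℕ.<? toℕ (i e)
  ... | yes e<ie rewrite dec-true (toℕ e ℕ.<? toℕ (i e)) e<ie = dec-false (toℕ (i e) ℕ.<? toℕ e) (ℕP.<⇒≯ e<ie)
  ... | no e≮ie rewrite dec-false (toℕ e ℕ.<? toℕ (i e)) e≮ie = dec-true (toℕ (i e) ℕ.<? toℕ e)
                    (ℕP.≤∧≢⇒< (ℕP.≮⇒≥ e≮ie) (edge⇒i≢ e-edge ∘ FP.toℕ-injective))

  pos-end : ∀ {e} → IsEdge e → pos e (l e) ≡ (r (i e) , 0)
  pos-end {e} e-edge rewrite dec-false (l e ℕP.≟ 0) (ℕP.>⇒≢ (edge⇒1≤l e-edge)) | dec-true (l e ℕP.≟ l e) refl =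
    refl

  newVertex : Fin n → ℕ → Point
  newVertex e q = if own e then (e , l e ℕ.+ q ∸ 1) else (i e , l e ℕ.+ (l e ∸ q) ∸ 1)

  pos-interior : ∀ {e q} → 0 ℕ.< q → q ℕ.< l e → pos e q ≡ newVertex e q
  pos-interior {e} {suc q} _ q<l rewrite dec-false (suc q ℕP.≟ l e) (ℕP.<⇒≢ q<l) = refl

  newVertex-owner : ∀ e q → proj₁ (newVertex e q) ≡ e ⊎ proj₁ (newVertex e q) ≡ i e
  newVertex-owner e q with own e
  ... | true = inj₁ refl
  ... | false = inj₂ refl

  newVertex-index : ∀ {e q} → 0 ℕ.< q → q ℕ.< l e → l e ℕ.≤ proj₂ (newVertex e q)
  newVertex-index {e} {q} 0<q q<l with own e
  ... | true = m≤m+n∸1 (l e) q 0<q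
  ... | false = m≤m+n∸1 (l e) (l e ∸ q) (ℕP.m<n⇒0<n∸m q<l)

  pos-i : ∀ {e} q → IsEdge e → q ℕ.≤ l e → pos (i e) q ≡ pos e (l e ∸ q)
  pos-i {e} q e-edge q≤l with position q q≤l
  ... | start = sym (pos-end e-edge)
  ... | end = begin
    pos (i e) (l e)       ≡⟨ cong (pos (i e)) (sym (l-i e)) ⟩
    pos (i e) (l (i e))   ≡⟨ pos-end (edge-i e-edge) ⟩
    (r (i (i e)) , 0)     ≡⟨ cong (λ x → (r x , 0)) (i-invol e) ⟩
    pos e 0               ≡⟨ cong (pos e) (sym (ℕP.n∸n≡0 (l e))) ⟩
    pos e (l e ∸ l e) ∎
    where open ≡-Reasoning
  ... | interior 0<q q<l = begin
    pos (i e) q                ≡⟨ pos-interior 0<q (subst (q ℕ.<_) (sym (l-i e)) q<l) ⟩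
    newVertex (i e) q          ≡⟨ flip ⟩
    newVertex e (l e ∸ q)      ≡⟨ sym (pos-interior (ℕP.m<n⇒0<n∸m q<l) (ℕP.∸-monoʳ-< 0<q q≤l)) ⟩
    pos e (l e ∸ q) ∎
    where
      open ≡-Reasoning
      flip : newVertex (i e) q ≡ newVertex e (l e ∸ q)
      flip rewrite own-i e-edge | l-i e | i-invol e with own e
      ... | true = refl
      ... | false = cong (λ m → (i e , l e ℕ.+ m ∸ 1)) (sym (ℕP.m∸[m∸n]≡n q≤l))

  data PointView : Point → Set where
    original  : ∀ {v} j → isV v ≡ true → PointView (v , j)
    half-edge : ∀ {e j} → IsEdge e → j ℕ.< l e → PointView (e , j)
    beyond    : ∀ {e j} → IsEdge e → ¬ j ℕ.< l e → PointView (e , j)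

  view : ∀ y → PointView y
  view (x , j) with isV x in x-kind
  ... | true = original j x-kind
  ... | false with j ℕ.<? l x
  ...   | yes j<l = half-edge x-kind j<l
  ...   | no j≮l = beyond x-kind j≮l

  rH-original : ∀ {v} j → isV v ≡ true → rH (v , j) ≡ (v , j)
  rH-original j v-vertex rewrite v-vertex = refl

  rH-half : ∀ {e j} → IsEdge e → j ℕ.< l e → rH (e , j) ≡ pos e j
  rH-half {e} {j} e-edge j<l rewrite e-edge | dec-true (j ℕ.<? l e) j<l = refl

  rH-beyond : ∀ {e j} → IsEdge e → ¬ j ℕ.< l e → rH (e , j) ≡ (e , j)
  rH-beyond {e} {j} e-edge j≮l rewrite e-edge | dec-false (j ℕ.<? l e) j≮l = refl

  iH-original : ∀ {v} j → isV v ≡ true → iH (v , j) ≡ (v , j)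
  iH-original j v-vertex rewrite v-vertex = refl

  iH-half : ∀ {e j} → IsEdge e → j ℕ.< l e → iH (e , j) ≡ (i e , l e ∸ 1 ∸ j)
  iH-half {e} {j} e-edge j<l rewrite e-edge | dec-true (j ℕ.<? l e) j<l = refl

  iH-beyond : ∀ {e j} → IsEdge e → ¬ j ℕ.< l e → iH (e , j) ≡ (e , j)
  iH-beyond {e} {j} e-edge j≮l rewrite e-edge | dec-false (j ℕ.<? l e) j≮l = refl

  tail-half : ∀ {e j} → IsEdge e → j ℕ.< l e → rH (iH (e , j)) ≡ pos e (suc j)
  tail-half {e} {j} e-edge j<l = begin
    rH (iH (e , j))            ≡⟨ cong rH (iH-half e-edge j<l) ⟩
    rH (i e , l e ∸ 1 ∸ j)     ≡⟨ rH-half (edge-i e-edge) (subst (l e ∸ 1 ∸ j ℕ.<_) (sym (l-i e)) k<l) ⟩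
    pos (i e) (l e ∸ 1 ∸ j)    ≡⟨ pos-i _ e-edge (ℕP.<⇒≤ k<l) ⟩
    pos e (l e ∸ (l e ∸ 1 ∸ j)) ≡⟨ cong (pos e) (trans (cong (l e ∸_) (ℕP.∸-+-assoc (l e) 1 j)) (ℕP.m∸[m∸n]≡n j<l)) ⟩
    pos e (suc j) ∎
    where
      open ≡-Reasoning
      k<l : l e ∸ 1 ∸ j ℕ.< l e
      k<l = ℕP.≤-<-trans (ℕP.m∸n≤m (l e ∸ 1) j) (ℕP.∸-monoʳ-< (s≤s z≤n) (edge⇒1≤l e-edge))

  pos-is-vertex : ∀ {x} q → IsEdge x → q ℕ.≤ l x → rH (pos x q) ≡ pos x q
  pos-is-vertex {x} q x-edge q≤l with position q q≤l
  ... | start = rH-original 0 (isV-r x)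
  ... | end rewrite pos-end x-edge = rH-original 0 (isV-r (i x))
  ... | interior 0<q q<l rewrite pos-interior 0<q q<l with own x
  ...   | true = rH-beyond x-edge (ℕP.≤⇒≯ (m≤m+n∸1 (l x) q 0<q))
  ...   | false = rH-beyond (edge-i x-edge)
                    (ℕP.≤⇒≯ (subst (ℕ._≤ l x ℕ.+ (l x ∸ q) ∸ 1) (sym (l-i x))
                                   (m≤m+n∸1 (l x) (l x ∸ q) (ℕP.m<n⇒0<n∸m q<l))))

  pos≢self : ∀ {x j} → IsEdge x → j ℕ.< l x → pos x j ≢ (x , j)
  pos≢self {x} {zero} x-edge _ eq = edge⇒r≢ x-edge (,-injectiveˡ eq)
  pos≢self {x} {suc j} x-edge j<l eq = ℕP.<⇒≱ j<l
    (subst (l x ℕ.≤_) (cong proj₂ (trans (sym (pos-interior (s≤s z≤n) j<l)) eq))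
                      (newVertex-index (s≤s z≤n) j<l))

  isVertexH-original : ∀ {v} j → isV v ≡ true → isVertex graph (v , j) ≡ true
  isVertexH-original j v-vertex = dec-true (rH _ ≟H _) (rH-original j v-vertex)

  isVertexH-half : ∀ {e j} → IsEdge e → j ℕ.< l e → isVertex graph (e , j) ≡ false
  isVertexH-half e-edge j<l = dec-false (rH _ ≟H _) (pos≢self e-edge j<l ∘ trans (sym (rH-half e-edge j<l)))

  isVertexH-beyond : ∀ {e j} → IsEdge e → ¬ j ℕ.< l e → isVertex graph (e , j) ≡ true
  isVertexH-beyond e-edge j≮l = dec-true (rH _ ≟H _) (rH-beyond e-edge j≮l)

  rH-idem : ∀ y → rH (rH y) ≡ rH y
  rH-idem y with view y
  ... | original j v-vertex rewrite rH-original j v-vertex = rH-original j v-vertex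
  ... | half-edge e-edge j<l rewrite rH-half e-edge j<l = pos-is-vertex _ e-edge (ℕP.<⇒≤ j<l)
  ... | beyond e-edge j≮l rewrite rH-beyond e-edge j≮l = rH-beyond e-edge j≮l

  iH-fixes-vertices : ∀ y → rH y ≡ y → iH y ≡ y
  iH-fixes-vertices y y-vertex with view y
  ... | original j v-vertex = iH-original j v-vertex
  ... | half-edge e-edge j<l = contradiction (trans (sym (rH-half e-edge j<l)) y-vertex) (pos≢self e-edge j<l)
  ... | beyond e-edge j≮l = iH-beyond e-edge j≮l

  ΣH-by-fibres : ∀ (f : Point → ℤ) → ΣX graph f ≡ sumℤ (map (λ x → sumBelow (λ j → f (x , j)) (size x)) (allFin n))
  ΣH-by-fibres f = trans (sum-concatMap f (λ x → map (x ,_) (upTo (size x))) (allFin n))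
    (sum-cong (allFin n) λ x → trans (cong sumℤ (sym (LP.map-∘ (upTo (size x)))))
                                      (sum-applyUpTo (λ j → f (x , j)) id (size x)))

  interior≢endpoint : ∀ {e q v} → IsEdge e → 0 ℕ.< q → q ℕ.< l e → pos e q ≢ (v , 0)
  interior≢endpoint {e} e-edge 0<q q<l eq = ℕP.<⇒≱ (edge⇒1≤l e-edge)
    (subst (l e ℕ.≤_) (cong proj₂ (trans (sym (pos-interior 0<q q<l)) eq)) (newVertex-index 0<q q<l))

  newVertex-injective : ∀ {e q₁ q₂} → IsEdge e → q₁ ℕ.≤ l e → q₂ ℕ.≤ l e →
    newVertex e q₁ ≡ newVertex e q₂ → q₁ ≡ q₂
  newVertex-injective {e} {q₁} {q₂} e-edge q₁≤l q₂≤l eq with own e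
  ... | true = cancel q₁ q₂ (cong proj₂ eq)
    where
      cancel : ∀ a b → l e ℕ.+ a ∸ 1 ≡ l e ℕ.+ b ∸ 1 → a ≡ b
      cancel a b eq′ = ℕP.+-cancelˡ-≡ (l e ∸ 1) a b
        (trans (sym (ℕP.+-∸-comm a (edge⇒1≤l e-edge))) (trans eq′ (ℕP.+-∸-comm b (edge⇒1≤l e-edge))))
  ... | false = ℕP.∸-cancelˡ-≡ q₁≤l q₂≤l (ℕP.+-cancelˡ-≡ (l e ∸ 1) _ _
      (trans (sym (ℕP.+-∸-comm (l e ∸ q₁) (edge⇒1≤l e-edge)))
        (trans (cong proj₂ eq) (ℕP.+-∸-comm (l e ∸ q₂) (edge⇒1≤l e-edge)))))

  pos-injective : ∀ {e q₁ q₂} → IsEdge e → q₁ ℕ.≤ l e → q₂ ℕ.≤ l e → pos e q₁ ≡ pos e q₂ → q₁ ≡ q₂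
  pos-injective {e} e-edge q₁≤l q₂≤l eq with position _ q₁≤l | position _ q₂≤l
  ... | start | start = refl
  ... | end | end = refl
  ... | start | end = contradiction (,-injectiveˡ (trans eq (pos-end e-edge))) (no-loop e (edge⇒r≢ e-edge))
  ... | end | start = contradiction (,-injectiveˡ (trans (sym eq) (pos-end e-edge))) (no-loop e (edge⇒r≢ e-edge))
  ... | start | interior 0<q q<l = contradiction (sym eq) (interior≢endpoint e-edge 0<q q<l)
  ... | interior 0<q q<l | start = contradiction eq (interior≢endpoint e-edge 0<q q<l)
  ... | end | interior 0<q q<l = contradiction (trans (sym eq) (pos-end e-edge)) (interior≢endpoint e-edge 0<q q<l)
  ... | interior 0<q q<l | end = contradiction (trans eq (pos-end e-edge)) (interior≢endpoint e-edge 0<q q<l)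
  ... | interior 0<q₁ q₁<l | interior 0<q₂ q₂<l = newVertex-injective e-edge q₁≤l q₂≤l
    (trans (sym (pos-interior 0<q₁ q₁<l)) (trans eq (pos-interior 0<q₂ q₂<l)))

  size-old : ∀ {x} → isV x ≡ true → size x ≡ 1
  size-old x-vertex rewrite x-vertex = refl

  size-edge : ∀ {x} → IsEdge x → l x ℕ.≤ size x
  size-edge {x} x-edge rewrite x-edge with own x
  ... | true = ℕP.m≤m+n (l x) _
  ... | false = ℕP.≤-refl

  data VertexH : Point → Set where
    old : ∀ v → isV v ≡ true → VertexH (v , 0)
    new : ∀ e p → IsEdge e → own e ≡ true → 0 ℕ.< p → p ℕ.< l e → VertexH (pos e p)

  vertexH-kind : ∀ y → y ∈ RawGraph.elems graph → rH y ≡ y → VertexH y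
  vertexH-kind y y∈ y-vertex with Any.satisfied (MP.∈-concatMap⁻ (λ x → map (x ,_) (upTo (size x))) {xs = allFin n} y∈)
  ... | x , y∈fibre with MP.∈-map⁻ (x ,_) y∈fibre
  ... | j , j∈ , refl with view (x , j)
  ...   | original _ x-vertex = subst (λ k → VertexH (x , k))
          (sym (ℕP.n<1⇒n≡0 (subst (j ℕ.<_) (size-old x-vertex) (MP.∈-upTo⁻ j∈)))) (old x x-vertex)
  ...   | half-edge x-edge j<l = contradiction (trans (sym (rH-half x-edge j<l)) y-vertex) (pos≢self x-edge j<l)
  ...   | beyond x-edge j≮l = beyond-vertex x-edge j≮l (MP.∈-upTo⁻ j∈)
    where
      beyond-vertex : ∀ {x j} → IsEdge x → ¬ j ℕ.< l x → j ℕ.< size x → VertexH (x , j)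
      beyond-vertex {x} {j} x-edge j≮l j<size rewrite x-edge with own x in x-owns
      ... | false = contradiction j<size j≮l
      ... | true = subst VertexH pos≡ (new x p x-edge x-owns (s≤s z≤n) p<l)
        where
          l≤j : l x ℕ.≤ j
          l≤j = ℕP.≮⇒≥ j≮l
          p : ℕ
          p = suc (j ∸ l x)
          j∸l<l∸1 : j ∸ l x ℕ.< l x ∸ 1
          j∸l<l∸1 = subst (j ∸ l x ℕ.<_) (ℕP.m+n∸m≡n (l x) (l x ∸ 1)) (ℕP.∸-monoˡ-< j<size l≤j)
          p<l : p ℕ.< l x
          p<l = subst (p ℕ.<_) (trans (ℕP.+-comm 1 (l x ∸ 1)) (ℕP.m∸n+n≡m (edge⇒1≤l x-edge))) (s≤s j∸l<l∸1)
          pos≡ : pos x p ≡ (x , j)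
          pos≡ rewrite pos-interior {x} (s≤s z≤n) p<l | x-owns =
            cong (x ,_) (trans (cong (_∸ 1) (ℕP.+-suc (l x) (j ∸ l x))) (ℕP.m+[n∸m]≡n l≤j))

  pos-owner : ∀ {x j} → 0 ℕ.< j → j ℕ.< l x → proj₁ (pos x j) ≡ x ⊎ proj₁ (pos x j) ≡ i x
  pos-owner {x} {j} 0<j j<l rewrite pos-interior {x} 0<j j<l = newVertex-owner x j

  pos-same-edge : ∀ {x j e p} → j ℕ.< l x → IsEdge e → 0 ℕ.< p → p ℕ.< l e →
    pos x j ≡ pos e p → x ≡ e ⊎ x ≡ i e
  pos-same-edge {j = zero} _ e-edge 0<p p<l eq = contradiction (sym eq) (interior≢endpoint e-edge 0<p p<l)
  pos-same-edge {x} {suc j} {e} j<l _ 0<p p<l eq with pos-owner {x} (s≤s z≤n) j<l | pos-owner {e} 0<p p<l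
  ... | inj₁ ox | inj₁ oe = inj₁ (trans (sym ox) (trans (cong proj₁ eq) oe))
  ... | inj₁ ox | inj₂ oe = inj₂ (trans (sym ox) (trans (cong proj₁ eq) oe))
  ... | inj₂ ox | inj₁ oe = inj₂ (trans (sym (i-invol x)) (cong i (trans (sym ox) (trans (cong proj₁ eq) oe))))
  ... | inj₂ ox | inj₂ oe =
    inj₁ (trans (sym (i-invol x)) (trans (cong i (trans (sym ox) (trans (cong proj₁ eq) oe))) (i-invol e)))

  fibreOutflow : (Point → ℤ) → Point → Fin n → ℤ
  fibreOutflow φ y x = sumBelow (λ j → outflow φ y (x , j)) (size x)

  Δ₁-by-fibres : ∀ φ y → Δ₁ φ y ≡ sumℤ (map (fibreOutflow φ y) (allFin n))
  Δ₁-by-fibres φ y = trans (Δ₁≡Σoutflow φ y) (ΣH-by-fibres (outflow φ y))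

  outflow-vanishes-off-half-edges : ∀ φ y {x j} → (IsEdge x → j ℕ.< l x → outflow φ y (x , j) ≡ + 0) →
    outflow φ y (x , j) ≡ + 0
  outflow-vanishes-off-half-edges φ y {x} {j} on-half with view (x , j)
  ... | original _ x-vertex = outflow-vanishes φ y _ (inj₁ (isVertexH-original j x-vertex))
  ... | half-edge x-edge j<l = on-half x-edge j<l
  ... | beyond x-edge j≮l = outflow-vanishes φ y _ (inj₁ (isVertexH-beyond x-edge j≮l))

  fibre-without-y : ∀ φ y x → (IsEdge x → ∀ j → j ℕ.< l x → pos x j ≢ y) → fibreOutflow φ y x ≡ + 0
  fibre-without-y φ y x avoids-y = sumBelow-zero _ (size x) λ j _ →
    outflow-vanishes-off-half-edges φ y λ x-edge j<l →
      outflow-vanishes φ y _ (inj₂ λ rH≡y → avoids-y x-edge j j<l (trans (sym (rH-half x-edge j<l)) rH≡y))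

  fibre-with-y : ∀ φ y x k → IsEdge x → k ℕ.< l x → pos x k ≡ y →
    (∀ j → j ℕ.< l x → pos x j ≡ y → j ≡ k) → fibreOutflow φ y x ≡ φ y - φ (pos x (suc k))
  fibre-with-y φ y x k x-edge k<l pos≡y unique = trans
    (sumBelow-single _ (size x) k (ℕP.<-≤-trans k<l (size-edge x-edge)) λ j _ j≢k →
      outflow-vanishes-off-half-edges φ y λ _ j<l →
        outflow-vanishes φ y _ (inj₂ λ rH≡y → j≢k (unique j j<l (trans (sym (rH-half x-edge j<l)) rH≡y))))
    (trans (outflow-along φ y _ (isVertexH-half x-edge k<l) (trans (rH-half x-edge k<l) pos≡y))
           (cong (λ z → φ y - φ z) (tail-half x-edge k<l)))

  pos≡endpoint⇒start : ∀ {x j v} → IsEdge x → j ℕ.< l x → pos x j ≡ (v , 0) → j ≡ 0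
  pos≡endpoint⇒start x-edge j<l eq with position _ (ℕP.<⇒≤ j<l)
  ... | start = refl
  ... | end = contradiction j<l (ℕP.n≮n _)
  ... | interior 0<j _ = contradiction eq (interior≢endpoint x-edge 0<j j<l)

  Δ₁-at-old : ∀ φ v → isV v ≡ true →
    Δ₁ φ (v , 0)
      ≡ sumℤ (map (λ x → if not (isV x) ∧ does (r x FP.≟ v) then φ (v , 0) - φ (pos x 1) else + 0) (allFin n))
  Δ₁-at-old φ v v-vertex = trans (Δ₁-by-fibres φ (v , 0)) (sum-cong (allFin n) λ x → fibre (isV x) refl)
    where
      fibre : ∀ {x} b → isV x ≡ b →
        fibreOutflow φ (v , 0) x ≡ (if not b ∧ does (r x FP.≟ v) then φ (v , 0) - φ (pos x 1) else + 0)
      fibre {x} true x-vertex = fibre-without-y φ _ x λ x-edge → contradiction (trans (sym x-vertex) x-edge) λ ()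
      fibre {x} false x-edge with r x FP.≟ v
      ... | yes rx≡v = fibre-with-y φ _ x 0 x-edge (edge⇒1≤l x-edge) (cong (_, 0) rx≡v)
                         λ _ j<l eq → pos≡endpoint⇒start x-edge j<l eq
      ... | no rx≢v = fibre-without-y φ _ x λ _ j j<l eq →
                        rx≢v (,-injectiveˡ (subst (λ k → pos x k ≡ (v , 0)) (pos≡endpoint⇒start x-edge j<l eq) eq))

  Δ₁-at-new : ∀ φ e p → IsEdge e → 0 ℕ.< p → p ℕ.< l e →
    Δ₁ φ (pos e p) ≡ (φ (pos e p) - φ (pos e (suc p))) + (φ (pos e p) - φ (pos e (p ∸ 1)))
  Δ₁-at-new φ e p e-edge 0<p p<l = begin
    Δ₁ φ w                                                ≡⟨ Δ₁-by-fibres φ w ⟩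
    sumℤ (map (fibreOutflow φ w) (allFin n))              ≡⟨ sum-allFin-pair _ e (i e) (edge⇒i≢ e-edge ∘ sym) others ⟩
    fibreOutflow φ w e + fibreOutflow φ w (i e)           ≡⟨ cong₂ _+_ fibre-e fibre-ie ⟩
    (φ w - φ (pos e (suc p))) + (φ w - φ (pos e (p ∸ 1))) ∎
    where
      open ≡-Reasoning
      w : Point
      w = pos e p
      p≤l : p ℕ.≤ l e
      p≤l = ℕP.<⇒≤ p<l
      ie-edge : IsEdge (i e)
      ie-edge = edge-i e-edge
      others : ∀ x → x ≢ e → x ≢ i e → fibreOutflow φ w x ≡ + 0
      others x x≢e x≢ie = fibre-without-y φ w x λ _ j j<l eq →
        [ x≢e , x≢ie ]′ (pos-same-edge j<l e-edge 0<p p<l eq)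
      fibre-e : fibreOutflow φ w e ≡ φ w - φ (pos e (suc p))
      fibre-e = fibre-with-y φ w e p e-edge p<l refl λ j j<l eq → pos-injective e-edge (ℕP.<⇒≤ j<l) p≤l eq
      l∸p<l : l e ∸ p ℕ.< l (i e)
      l∸p<l = subst (l e ∸ p ℕ.<_) (sym (l-i e)) (ℕP.∸-monoʳ-< 0<p p≤l)
      pos-ie : ∀ j → j ℕ.≤ l (i e) → pos (i e) j ≡ pos e (l e ∸ j)
      pos-ie j j≤l = pos-i j e-edge (subst (j ℕ.≤_) (l-i e) j≤l)
      fibre-ie : fibreOutflow φ w (i e) ≡ φ w - φ (pos e (p ∸ 1))
      fibre-ie = trans
        (fibre-with-y φ w (i e) (l e ∸ p) ie-edge l∸p<l
          (trans (pos-ie _ (ℕP.<⇒≤ l∸p<l)) (cong (pos e) (ℕP.m∸[m∸n]≡n p≤l)))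
          λ j j<l eq → trans (sym (ℕP.m∸[m∸n]≡n (subst (j ℕ.≤_) (l-i e) (ℕP.<⇒≤ j<l))))
                             (cong (l e ∸_) (pos-injective e-edge (ℕP.m∸n≤m (l e) j) p≤l
                                                 (trans (sym (pos-ie j (ℕP.<⇒≤ j<l))) eq))))
        (cong (λ z → φ w - φ z) (trans (pos-ie _ l∸p<l) (cong (pos e) l∸[1+l∸p]≡p∸1)))
        where
          l∸[1+l∸p]≡p∸1 : l e ∸ suc (l e ∸ p) ≡ p ∸ 1
          l∸[1+l∸p]≡p∸1 = trans (cong (l e ∸_) (ℕP.+-comm 1 (l e ∸ p)))
                             (trans (sym (ℕP.∸-+-assoc (l e) (l e ∸ p) 1)) (cong (_∸ 1) (ℕP.m∸[m∸n]≡n p≤l)))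

  Γ : RawGraph
  Γ = FinGraph n r i

  slope : (Fin n → ℤ) → Fin n → ℤ
  slope g x = quot Γ (g (r x) - g (r (i x))) (l x)

  -- A point (x , k) with l x ≤ k is the new vertex at distance k + 1 − l x from r x,
  -- so this is g interpolated linearly along every edge.
  interpolate : (Fin n → ℤ) → Point → ℤ
  interpolate g (x , k) = if isV x then g x else g (r x) - + (k ℕ.+ 1 ∸ l x) * slope g x

  interpolate-beyond : ∀ g {x} k → IsEdge x → interpolate g (x , k) ≡ g (r x) - + (k ℕ.+ 1 ∸ l x) * slope g x
  interpolate-beyond g k x-edge rewrite x-edge = refl

  module _ (g : Fin n → ℤ) (g-PL : IsPL Γ l g) where

    slope-exact : ∀ {e} → IsEdge e → g (r e) - g (r (i e)) ≡ slope g e * + l e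
    slope-exact {e} e-edge with l e | edge⇒1≤l e-edge | g-PL e (MP.∈-allFin e)
    ... | suc k | _ | l∣g = ∣⇒≡[/ℕ]* _ (suc k) l∣g

    slope-i : ∀ {e} → IsEdge e → slope g (i e) ≡ - slope g e
    slope-i {e} e-edge = ℤP.*-cancelʳ-≡ _ _ (+ l e) {{ℕ.>-nonZero (edge⇒1≤l e-edge)}} (begin
      slope g (i e) * + l e         ≡⟨ cong (λ L → slope g (i e) * + L) (sym (l-i e)) ⟩
      slope g (i e) * + l (i e)     ≡⟨ sym (slope-exact (edge-i e-edge)) ⟩
      g (r (i e)) - g (r (i (i e))) ≡⟨ cong (λ z → g (r (i e)) - g (r z)) (i-invol e) ⟩
      g (r (i e)) - g (r e)         ≡⟨ antisym (g (r e)) (g (r (i e))) ⟩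
      - (g (r e) - g (r (i e)))     ≡⟨ cong -_ (slope-exact e-edge) ⟩
      - (slope g e * + l e)         ≡⟨ ℤP.neg-distribˡ-* (slope g e) (+ l e) ⟩
      - slope g e * + l e ∎)
      where
        open ≡-Reasoning
        antisym : ∀ a b → b - a ≡ - (a - b)
        antisym = solve-∀

    interpolate-pos : ∀ {e} q → IsEdge e → q ℕ.≤ l e → interpolate g (pos e q) ≡ g (r e) - + q * slope g e
    interpolate-pos {e} q e-edge q≤l with position q q≤l
    ... | start rewrite isV-r e = sym (ℤP.+-identityʳ _)
    ... | end rewrite pos-end e-edge | isV-r (i e) =
      solve-at-end (g (r e)) (g (r (i e))) (+ l e) (slope g e) (slope-exact e-edge)
      where
        solve-at-end : ∀ a b L s → a - b ≡ s * L → b ≡ a - L * s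
        solve-at-end a b L s a-b≡sL = trans (sym (cancel a b)) (cong (λ t → a - t) (trans a-b≡sL (ℤP.*-comm s L)))
          where
            cancel : ∀ a b → a - (a - b) ≡ b
            cancel = solve-∀
    ... | interior 0<q q<l rewrite pos-interior {e} 0<q q<l with own e
    ...   | true = trans (interpolate-beyond g _ e-edge)
                         (cong (λ d → g (r e) - + d * slope g e) ([m+n∸1]+1∸m≡n (l e) q (edge⇒1≤l e-edge)))
    ...   | false = begin
      interpolate g (i e , l e ℕ.+ (l e ∸ q) ∸ 1)
        ≡⟨ interpolate-beyond g _ (edge-i e-edge) ⟩
      g (r (i e)) - + (l e ℕ.+ (l e ∸ q) ∸ 1 ℕ.+ 1 ∸ l (i e)) * slope g (i e)
        ≡⟨ cong₂ (λ d s → g (r (i e)) - + d * s)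
                 (trans (cong (l e ℕ.+ (l e ∸ q) ∸ 1 ℕ.+ 1 ∸_) (l-i e)) ([m+n∸1]+1∸m≡n (l e) (l e ∸ q) (edge⇒1≤l e-edge)))
                 (slope-i e-edge) ⟩
      g (r (i e)) - + (l e ∸ q) * - slope g e
        ≡⟨ cong (λ d → g (r (i e)) - d * - slope g e) (+[m∸n]≡+m-+n q≤l) ⟩
      g (r (i e)) - (+ l e - + q) * - slope g e
        ≡⟨ from-far-end (g (r e)) (g (r (i e))) (+ l e) (+ q) (slope g e) (slope-exact e-edge) ⟩
      g (r e) - + q * slope g e ∎
      where
        open ≡-Reasoning
        from-far-end : ∀ a b L q s → a - b ≡ s * L → b - (L - q) * (- s) ≡ a - q * s
        from-far-end a b L q s a-b≡sL =
          trans (cong (λ b → b - (L - q) * (- s)) (trans (sym (cancel a b)) (cong (λ t → a - t) a-b≡sL))) (regroup a L q s)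
          where
            cancel : ∀ a b → a - (a - b) ≡ b
            cancel = solve-∀
            regroup : ∀ a L q s → (a - s * L) - (L - q) * (- s) ≡ a - q * s
            regroup = solve-∀

    Δ₁-interpolate-old : ∀ v → isV v ≡ true → Δ₁ (interpolate g) (v , 0) ≡ Δ Γ l g v
    Δ₁-interpolate-old v v-vertex =
      trans (Δ₁-at-old (interpolate g) v v-vertex) (sum-cong (allFin n) λ x → termwise (isV x) refl)
      where
        one-step : ∀ a s → a - (a - + 1 * s) ≡ s
        one-step = solve-∀
        termwise : ∀ {x} b → isV x ≡ b →
          (if not b ∧ does (r x FP.≟ v) then interpolate g (v , 0) - interpolate g (pos x 1) else + 0)
            ≡ (if not b ∧ does (r x FP.≟ v) then quot Γ (g v - g (r (i x))) (l x) else + 0)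
        termwise true _ = refl
        termwise {x} false x-edge with r x FP.≟ v
        ... | no _ = refl
        ... | yes refl rewrite v-vertex | interpolate-pos 1 x-edge (edge⇒1≤l x-edge) = one-step (g (r x)) (slope g x)

    Δ₁-interpolate-new : ∀ e p → IsEdge e → 0 ℕ.< p → p ℕ.< l e → Δ₁ (interpolate g) (pos e p) ≡ + 0
    Δ₁-interpolate-new e p e-edge 0<p p<l = begin
      Δ₁ (interpolate g) (pos e p)
        ≡⟨ Δ₁-at-new (interpolate g) e p e-edge 0<p p<l ⟩
      (interpolate g (pos e p) - interpolate g (pos e (suc p))) + (interpolate g (pos e p) - interpolate g (pos e (p ∸ 1)))
        ≡⟨ cong₂ (λ a b → (a - b) + (a - interpolate g (pos e (p ∸ 1))))
                 (interpolate-pos p e-edge (ℕP.<⇒≤ p<l)) (interpolate-pos (suc p) e-edge p<l) ⟩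
      (A - + p * s - (A - + suc p * s)) + (A - + p * s - interpolate g (pos e (p ∸ 1)))
        ≡⟨ cong (λ z → (A - + p * s - (A - + suc p * s)) + (A - + p * s - z))
                (interpolate-pos (p ∸ 1) e-edge (ℕP.≤-trans (ℕP.m∸n≤m p 1) (ℕP.<⇒≤ p<l))) ⟩
      (A - + p * s - (A - + suc p * s)) + (A - + p * s - (A - + (p ∸ 1) * s))
        ≡⟨ cong₂ (λ a b → (A - + p * s - (A - a * s)) + (A - + p * s - (A - b * s))) (ℤP.pos-+ 1 p) (+[m∸n]≡+m-+n 0<p) ⟩
      (A - + p * s - (A - (+ 1 + + p) * s)) + (A - + p * s - (A - (+ p - + 1) * s))
        ≡⟨ second-difference A (+ p) s ⟩
      + 0 ∎
      where
        open ≡-Reasoning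
        A s : ℤ
        A = g (r e)
        s = slope g e
        second-difference : ∀ a p s → (a - p * s - (a - (+ 1 + p) * s)) + (a - p * s - (a - (p - + 1) * s)) ≡ + 0
        second-difference = solve-∀

  chips : ℕ → Fin n → Fin n → ℤ
  chips k v x = if does (v FP.≟ x) then + k else + 0

  chips≥0 : ∀ k v x → + 0 ≤ chips k v x
  chips≥0 k v x with does (v FP.≟ x)
  ... | true = ℤ.+≤+ z≤n
  ... | false = ℤ.+≤+ z≤n

  vertex≢edge : ∀ {x e} → isV x ≡ true → IsEdge e → x ≢ e
  vertex≢edge x-vertex e-edge refl = contradiction (trans (sym x-vertex) e-edge) λ ()

  module TentPotential (e : Fin n) (p : ℕ) (e-edge : IsEdge e) (owned : own e ≡ true)
                       (0<p : 0 ℕ.< p) (p<l : p ℕ.< l e) where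
    open Tent (l e) p 0<p p<l

    ψ : Point → ℤ
    -- the tent along e, in the encoding of interpolate
    ψ (x , k) = if does (x FP.≟ e) then + tent (k ℕ.+ 1 ∸ l e) else + 0

    ψ-off-e : ∀ y → proj₁ y ≢ e → ψ y ≡ + 0
    ψ-off-e (x , k) x≢e rewrite dec-false (x FP.≟ e) x≢e = refl

    ψ-along : ∀ q → q ℕ.≤ l e → ψ (pos e q) ≡ + tent q
    ψ-along q q≤l with position q q≤l
    ... | start = ψ-off-e (r e , 0) (vertex≢edge (isV-r e) e-edge)
    ... | end = trans (cong ψ (pos-end e-edge))
                      (trans (ψ-off-e (r (i e) , 0) (vertex≢edge (isV-r (i e)) e-edge)) (cong +_ (sym tent-L)))
    ... | interior 0<q q<l rewrite pos-interior {e} 0<q q<l | owned | dec-true (e FP.≟ e) refl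
                                 | [m+n∸1]+1∸m≡n (l e) q (edge⇒1≤l e-edge) = refl

    ψ-along-i : ∀ q → q ℕ.≤ l e → ψ (pos (i e) q) ≡ + tent (l e ∸ q)
    ψ-along-i q q≤l = trans (cong ψ (pos-i q e-edge q≤l)) (ψ-along (l e ∸ q) (ℕP.m∸n≤m (l e) q))

    ψ-elsewhere : ∀ e′ q → IsEdge e′ → q ℕ.≤ l e′ → e′ ≢ e → e′ ≢ i e → ψ (pos e′ q) ≡ + 0
    ψ-elsewhere e′ q e′-edge q≤l e′≢e e′≢ie with position q q≤l
    ... | start = ψ-off-e (r e′ , 0) (vertex≢edge (isV-r e′) e-edge)
    ... | end = trans (cong ψ (pos-end e′-edge)) (ψ-off-e (r (i e′) , 0) (vertex≢edge (isV-r (i e′)) e-edge))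
    ... | interior 0<q q<l = ψ-off-e (pos e′ q) (owner≢e (pos-owner 0<q q<l))
      where
        owner≢e : ∀ {o} → o ≡ e′ ⊎ o ≡ i e′ → o ≢ e
        owner≢e (inj₁ o≡e′) o≡e = e′≢e (trans (sym o≡e′) o≡e)
        owner≢e (inj₂ o≡ie′) o≡e = e′≢ie (trans (sym (i-invol e′)) (cong i (trans (sym o≡ie′) o≡e)))

    Δ₁ψ-old : ∀ x → isV x ≡ true → Δ₁ ψ (x , 0) ≡ - chips 1 (r e) x - chips 1 (r (i e)) x
    Δ₁ψ-old x x-vertex = trans (Δ₁-at-old ψ x x-vertex)
      (trans (sum-allFin-pair _ e (i e) (edge⇒i≢ e-edge ∘ sym) λ x′ → others (isV x′) refl)
             (cong₂ _+_ (along e e-edge (trans (ψ-along 1 (edge⇒1≤l e-edge)) (cong +_ tent-1)))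
                        (along (i e) (edge-i e-edge) (trans (ψ-along-i 1 (edge⇒1≤l e-edge)) (cong +_ tent-L∸1)))))
      where
        ψx≡0 : ψ (x , 0) ≡ + 0
        ψx≡0 = ψ-off-e (x , 0) (vertex≢edge x-vertex e-edge)
        others : ∀ {x′} b → isV x′ ≡ b → x′ ≢ e → x′ ≢ i e →
          (if not b ∧ does (r x′ FP.≟ x) then ψ (x , 0) - ψ (pos x′ 1) else + 0) ≡ + 0
        others true _ _ _ = refl
        others {x′} false x′-edge x′≢e x′≢ie
          rewrite ψx≡0 | ψ-elsewhere x′ 1 x′-edge (edge⇒1≤l x′-edge) x′≢e x′≢ie with does (r x′ FP.≟ x)
        ... | true = refl
        ... | false = refl
        along : ∀ x′ → IsEdge x′ → ψ (pos x′ 1) ≡ + 1 →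
          (if not (isV x′) ∧ does (r x′ FP.≟ x) then ψ (x , 0) - ψ (pos x′ 1) else + 0) ≡ - chips 1 (r x′) x
        along x′ x′-edge ψ≡1 rewrite x′-edge | ψx≡0 | ψ≡1 with does (r x′ FP.≟ x)
        ... | true = refl
        ... | false = refl

    Δ₁ψ-along : ∀ q → 0 ℕ.< q → q ℕ.< l e →
      Δ₁ ψ (pos e q) ≡ (+ tent q - + tent (suc q)) + (+ tent q - + tent (q ∸ 1))
    Δ₁ψ-along q 0<q q<l = trans (Δ₁-at-new ψ e q e-edge 0<q q<l)
      (cong₂ _+_ (cong₂ _-_ (ψ-along q (ℕP.<⇒≤ q<l)) (ψ-along (suc q) q<l))
                 (cong₂ _-_ (ψ-along q (ℕP.<⇒≤ q<l)) (ψ-along (q ∸ 1) (ℕP.≤-trans (ℕP.m∸n≤m q 1) (ℕP.<⇒≤ q<l)))))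

    Δ₁ψ-peak : + 1 ≤ Δ₁ ψ (pos e p)
    Δ₁ψ-peak = subst (+ 1 ≤_) (sym (Δ₁ψ-along p 0<p p<l))
      (≤-double⇒≤-differences (tent p) (tent (suc p)) (tent (p ∸ 1)) 1 tent-peak)

    Δ₁ψ-new : ∀ e′ q → IsEdge e′ → own e′ ≡ true → 0 ℕ.< q → q ℕ.< l e′ → + 0 ≤ Δ₁ ψ (pos e′ q)
    Δ₁ψ-new e′ q e′-edge e′-owned 0<q q<l with e′ FP.≟ e
    ... | yes refl = subst (+ 0 ≤_) (sym (Δ₁ψ-along q 0<q q<l))
      (≤-double⇒≤-differences (tent q) (tent (suc q)) (tent (q ∸ 1)) 0
        (ℕP.≤-trans (ℕP.≤-reflexive (ℕP.+-identityʳ _)) (tent-concave q 0<q q<l)))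
    ... | no e′≢e = ℤP.≤-reflexive (sym (trans (Δ₁-at-new ψ e′ q e′-edge 0<q q<l)
          (cong₂ _+_ (cong₂ _-_ (vanishes q (ℕP.<⇒≤ q<l)) (vanishes (suc q) q<l))
                     (cong₂ _-_ (vanishes q (ℕP.<⇒≤ q<l)) (vanishes (q ∸ 1) (ℕP.≤-trans (ℕP.m∸n≤m q 1) (ℕP.<⇒≤ q<l)))))))
      where
        e′≢ie : e′ ≢ i e
        e′≢ie refl = contradiction (trans (sym e′-owned) (trans (own-i e-edge) (cong not owned))) λ ()
        vanishes : ∀ k → k ℕ.≤ l e′ → ψ (pos e′ k) ≡ + 0
        vanishes k k≤l = ψ-elsewhere e′ k e′-edge k≤l e′≢e e′≢ie

-- Chip firing on the subdivision

module ChipFiring {n : ℕ} {r i : Fin n → Fin n} {l : Fin n → ℕ} (axioms : LooplessMetricGraph n r i l)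
  (D : Fin n → ℤ) (j : ℕ) (1≤j : 1 ℕ.≤ j)
  (rank-j : ∀ F → IsDivisor (FinGraph n r i) F → Effective (FinGraph n r i) F → deg (FinGraph n r i) F ≡ + j →
              LinSysNonempty (FinGraph n r i) l (D ⊖ F)) where

  open LooplessMetricGraph axioms
  open Subdivided axioms

  lift : (Fin n → ℤ) → Point → ℤ
  lift f (x , k) = if isV x then f x else + 0

  D′ : Point → ℤ
  D′ = lift D

  lift-old : ∀ f {x} k → isV x ≡ true → lift f (x , k) ≡ f x
  lift-old f k x-vertex rewrite x-vertex = refl

  lift-edge : ∀ f {x} k → IsEdge x → lift f (x , k) ≡ + 0
  lift-edge f k x-edge rewrite x-edge = refl

  lift-new : ∀ f {e p} → IsEdge e → 0 ℕ.< p → p ℕ.< l e → lift f (pos e p) ≡ + 0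
  lift-new f {e} {p} e-edge 0<p p<l with pos-owner {e} 0<p p<l
  ... | inj₁ owner≡e = lift-edge f (proj₂ (pos e p)) (subst IsEdge (sym owner≡e) e-edge)
  ... | inj₂ owner≡ie = lift-edge f (proj₂ (pos e p)) (subst IsEdge (sym owner≡ie) (edge-i e-edge))

  record Removal (v : Fin n) : Set where
    field
      E g    : Fin n → ℤ
      g-PL   : IsPL Γ l g
      E≥0    : ∀ x → + 0 ≤ E x
      E∼D-jv : ∀ x → E x - (D x - chips j v x) ≡ Δ Γ l g x

  removal : ∀ v → isV v ≡ true → Removal v
  removal v v-vertex = fromLinearSystem (rank-j (chips j v) jv-divisor jv≥0 deg-jv)
    where
      fromLinearSystem : LinSysNonempty Γ l (D ⊖ chips j v) → Removal v
      fromLinearSystem (E , _ , E≥0 , g , g-PL , E∼) = record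
        { E = E ; g = g ; g-PL = g-PL ; E≥0 = λ x → E≥0 x (MP.∈-allFin x) ; E∼D-jv = λ x → E∼ x (MP.∈-allFin x) }
      jv-divisor : IsDivisor Γ (chips j v)
      jv-divisor x _ x-edge with v FP.≟ x
      ... | yes refl = contradiction (isV⇒r≡ v-vertex) x-edge
      ... | no _ = refl
      jv≥0 : Effective Γ (chips j v)
      jv≥0 x _ = chips≥0 j v x
      deg-jv : deg Γ (chips j v) ≡ + j
      deg-jv = trans (sum-allFin-single _ v off-v) at-v
        where
          off-v : ∀ x → x ≢ v → (if isV x then chips j v x else + 0) ≡ + 0
          off-v x x≢v rewrite dec-false (v FP.≟ x) (x≢v ∘ sym) with isV x
          ... | true = refl
          ... | false = refl
          at-v : (if isV v then chips j v v else + 0) ≡ + j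
          at-v rewrite v-vertex | dec-true (v FP.≟ v) refl = refl

  module Fired {v : Fin n} (R : Removal v) where
    open Removal R

    fired : Point → ℤ
    fired = D′ ⊕ Δ₁ (interpolate g)

    fired-old : ∀ x → isV x ≡ true → fired (x , 0) ≡ E x + chips j v x
    fired-old x x-vertex = begin
      D′ (x , 0) + Δ₁ (interpolate g) (x , 0)   ≡⟨ cong₂ _+_ (lift-old D 0 x-vertex) (Δ₁-interpolate-old g g-PL x x-vertex) ⟩
      D x + Δ Γ l g x                            ≡⟨ cong (λ d → D x + d) (sym (E∼D-jv x)) ⟩
      D x + (E x - (D x - chips j v x))          ≡⟨ cancel (D x) (E x) (chips j v x) ⟩
      E x + chips j v x ∎
      where
        open ≡-Reasoning
        cancel : ∀ d e c → d + (e - (d - c)) ≡ e + c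
        cancel = solve-∀

    fired-new : ∀ e p → IsEdge e → 0 ℕ.< p → p ℕ.< l e → fired (pos e p) ≡ + 0
    fired-new e p e-edge 0<p p<l =
      cong₂ _+_ (lift-new D e-edge 0<p p<l) (Δ₁-interpolate-new g g-PL e p e-edge 0<p p<l)

    fired≥0 : ∀ y → VertexH y → + 0 ≤ fired y
    fired≥0 _ (old x x-vertex) = subst (+ 0 ≤_) (sym (fired-old x x-vertex)) (ℤP.+-mono-≤ (E≥0 x) (chips≥0 j v x))
    fired≥0 _ (new e p e-edge _ 0<p p<l) = ℤP.≤-reflexive (sym (fired-new e p e-edge 0<p p<l))

    fired-at-v : isV v ≡ true → + 1 ≤ fired (v , 0)
    fired-at-v v-vertex rewrite fired-old v v-vertex | dec-true (v FP.≟ v) refl =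
      ℤP.≤-trans (ℤ.+≤+ 1≤j) (ℤP.i≤j+i _ _ {{ℤ.nonNegative (E≥0 v)}})

  open Fired using (fired; fired-new; fired≥0; fired-at-v)

  remove-old-chip : ∀ v → isV v ≡ true → ∃ λ g → ∀ y → VertexH y → + 0 ≤ (D′ ⊕ Δ₁ g ⊖ chip (v , 0)) y
  remove-old-chip v v-vertex = interpolate (Removal.g R) , chip-removable (fired R) (v , 0) (fired≥0 R) (fired-at-v R v-vertex)
    where
      R : Removal v
      R = removal v v-vertex

  module NewVertexChip (e : Fin n) (p : ℕ) (e-edge : IsEdge e) (owned : own e ≡ true)
                       (0<p : 0 ℕ.< p) (p<l : p ℕ.< l e) where
    u v : Fin n
    u = r e
    v = r (i e)

    Ru : Removal u
    Ru = removal u (isV-r e)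
    Rv : Removal v
    Rv = removal v (isV-r (i e))

    gu gv : Fin n → ℤ
    gu = Removal.g Ru
    gv = Removal.g Rv

    φu φv Φ : Point → ℤ
    φu = interpolate gu
    φv = interpolate gv
    Φ = φu ⊖ φv

    w : Point
    w = pos e p

    t σ : ℤ
    t = Φ w
    σ = slope gu e - slope gv e

    c₀ : ℤ
    c₀ = gu u - gv u

    Φ-along : ∀ q → q ℕ.≤ l e → Φ (pos e q) ≡ c₀ - + q * σ
    Φ-along q q≤l = begin
      φu (pos e q) - φv (pos e q)
        ≡⟨ cong₂ _-_ (interpolate-pos gu (Removal.g-PL Ru) q e-edge q≤l) (interpolate-pos gv (Removal.g-PL Rv) q e-edge q≤l) ⟩
      (gu u - + q * slope gu e) - (gv u - + q * slope gv e)
        ≡⟨ regroup (gu u) (gv u) (+ q) (slope gu e) (slope gv e) ⟩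
      c₀ - + q * σ ∎
      where
        open ≡-Reasoning
        regroup : ∀ a b q s₁ s₂ → (a - q * s₁) - (b - q * s₂) ≡ (a - b) - q * (s₁ - s₂)
        regroup = solve-∀

    g₁ : Point → ℤ
    g₁ = φv ⊕ Φ ⊓ᶜ t

    fired₁ : Point → ℤ
    fired₁ = D′ ⊕ Δ₁ g₁

    fired₁≥0 : ∀ y → VertexH y → + 0 ≤ fired₁ y
    fired₁≥0 y y-vertex with ℤP.≤-total (Φ y) t
    ... | inj₁ Φy≤t = ℤP.≤-trans (fired≥0 Ru y y-vertex) (ℤP.+-monoʳ-≤ (D′ y) (Δ₁-min-≥ˡ φu φv t y Φy≤t))
    ... | inj₂ t≤Φy = ℤP.≤-trans (fired≥0 Rv y y-vertex) (ℤP.+-monoʳ-≤ (D′ y) (Δ₁-min-≥ʳ φu φv t y t≤Φy))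

    fired₁-at-w : σ ≢ + 0 → + 1 ≤ fired₁ w
    fired₁-at-w σ≢0 = subst (+ 1 ≤_) (sym fired₁w≡kink) (kink≥1 t σ σ≢0)
      where
        open ≡-Reasoning
        Φ-after : Φ (pos e (suc p)) ≡ t - σ
        Φ-after = begin
          Φ (pos e (suc p))   ≡⟨ Φ-along (suc p) p<l ⟩
          c₀ - + suc p * σ    ≡⟨ cong (λ q → c₀ - q * σ) (ℤP.pos-+ 1 p) ⟩
          c₀ - (+ 1 + + p) * σ ≡⟨ step c₀ (+ p) σ ⟩
          (c₀ - + p * σ) - σ   ≡⟨ cong (_- σ) (sym (Φ-along p (ℕP.<⇒≤ p<l))) ⟩
          t - σ ∎
          where
            step : ∀ c q s → c - (+ 1 + q) * s ≡ (c - q * s) - s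
            step = solve-∀
        Φ-before : Φ (pos e (p ∸ 1)) ≡ t + σ
        Φ-before = begin
          Φ (pos e (p ∸ 1))    ≡⟨ Φ-along (p ∸ 1) (ℕP.≤-trans (ℕP.m∸n≤m p 1) (ℕP.<⇒≤ p<l)) ⟩
          c₀ - + (p ∸ 1) * σ   ≡⟨ cong (λ q → c₀ - q * σ) (+[m∸n]≡+m-+n 0<p) ⟩
          c₀ - (+ p - + 1) * σ ≡⟨ step c₀ (+ p) σ ⟩
          (c₀ - + p * σ) + σ   ≡⟨ cong (_+ σ) (sym (Φ-along p (ℕP.<⇒≤ p<l))) ⟩
          t + σ ∎
          where
            step : ∀ c q s → c - (q - + 1) * s ≡ (c - q * s) + s
            step = solve-∀
        fired₁w≡kink : fired₁ w ≡ (t - (t - σ) ⊓ t) + (t - (t + σ) ⊓ t)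
        fired₁w≡kink = begin
          D′ w + Δ₁ (φv ⊕ Φ ⊓ᶜ t) w                ≡⟨ cong (λ d → D′ w + d) (Δ₁-⊕ φv (Φ ⊓ᶜ t) w) ⟩
          D′ w + (Δ₁ φv w + Δ₁ (Φ ⊓ᶜ t) w)          ≡⟨ sym (ℤP.+-assoc (D′ w) _ _) ⟩
          fired Rv w + Δ₁ (Φ ⊓ᶜ t) w               ≡⟨ cong (_+ Δ₁ (Φ ⊓ᶜ t) w) (fired-new Rv e p e-edge 0<p p<l) ⟩
          + 0 + Δ₁ (Φ ⊓ᶜ t) w                      ≡⟨ ℤP.+-identityˡ _ ⟩
          Δ₁ (Φ ⊓ᶜ t) w                            ≡⟨ Δ₁-at-new (Φ ⊓ᶜ t) e p e-edge 0<p p<l ⟩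
          (t ⊓ t - Φ (pos e (suc p)) ⊓ t) + (t ⊓ t - Φ (pos e (p ∸ 1)) ⊓ t)
            ≡⟨ cong₂ _+_ (cong₂ _-_ (ℤP.⊓-idem t) (cong (_⊓ t) Φ-after)) (cong₂ _-_ (ℤP.⊓-idem t) (cong (_⊓ t) Φ-before)) ⟩
          (t - (t - σ) ⊓ t) + (t - (t + σ) ⊓ t) ∎

    module Flat (σ≡0 : σ ≡ + 0) where
      open TentPotential e p e-edge owned 0<p p<l

      Φ≡c₀ : ∀ q → q ℕ.≤ l e → Φ (pos e q) ≡ c₀
      Φ≡c₀ q q≤l = trans (Φ-along q q≤l) (trans (cong (λ s → c₀ - + q * s) σ≡0) (no-slope c₀ (+ q)))
        where
          no-slope : ∀ c q → c - q * + 0 ≡ c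
          no-slope = solve-∀

      Φ-constant : ∀ q → q ℕ.≤ l e → Φ (pos e q) ≡ t
      Φ-constant q q≤l = trans (Φ≡c₀ q q≤l) (sym (Φ≡c₀ p (ℕP.<⇒≤ p<l)))

      fired₁-at-u : + 1 ≤ fired₁ (u , 0)
      fired₁-at-u = ℤP.≤-trans (fired-at-v Ru (isV-r e))
        (ℤP.+-monoʳ-≤ (D′ (u , 0)) (Δ₁-min-≥ˡ φu φv t (u , 0) (ℤP.≤-reflexive (Φ-constant 0 z≤n))))

      fired₁-at-v : + 1 ≤ fired₁ (v , 0)
      fired₁-at-v = ℤP.≤-trans (fired-at-v Rv (isV-r (i e)))
        (ℤP.+-monoʳ-≤ (D′ (v , 0)) (Δ₁-min-≥ʳ φu φv t (v , 0)
          (ℤP.≤-reflexive (sym (trans (cong Φ (sym (pos-end e-edge))) (Φ-constant (l e) ℕP.≤-refl))))))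

      g₂ : Point → ℤ
      g₂ = g₁ ⊕ ψ

      endpoint-chips-removable : ∀ x a → + 0 ≤ a → (u ≡ x → + 1 ≤ a) → (v ≡ x → + 1 ≤ a) →
        + 0 ≤ a + (- chips 1 u x - chips 1 v x)
      endpoint-chips-removable x a a≥0 1≤a-at-u 1≤a-at-v with u FP.≟ x | v FP.≟ x
      ... | yes u≡x | yes v≡x = contradiction (trans u≡x (sym v≡x)) (no-loop e (edge⇒r≢ e-edge))
      ... | yes u≡x | no _ = ℤP.i≤j⇒0≤j-i (1≤a-at-u u≡x)
      ... | no _ | yes v≡x = ℤP.i≤j⇒0≤j-i (1≤a-at-v v≡x)
      ... | no _ | no _ = subst (+ 0 ≤_) (sym (ℤP.+-identityʳ a)) a≥0

      fired₂-split : ∀ y → (D′ ⊕ Δ₁ g₂) y ≡ fired₁ y + Δ₁ ψ y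
      fired₂-split y = trans (cong (λ d → D′ y + d) (Δ₁-⊕ g₁ ψ y)) (sym (ℤP.+-assoc (D′ y) _ _))

      fired₂≥0 : ∀ y → VertexH y → + 0 ≤ (D′ ⊕ Δ₁ g₂) y
      fired₂≥0 _ (old x x-vertex) =
        subst (+ 0 ≤_) (sym (trans (fired₂-split (x , 0)) (cong (λ d → fired₁ (x , 0) + d) (Δ₁ψ-old x x-vertex))))
          (endpoint-chips-removable x (fired₁ (x , 0)) (fired₁≥0 (x , 0) (old x x-vertex))
            (λ { refl → fired₁-at-u }) (λ { refl → fired₁-at-v }))
      fired₂≥0 _ (new e′ q e′-edge e′-owned 0<q q<l) rewrite fired₂-split (pos e′ q) =
        ℤP.+-mono-≤ (fired₁≥0 _ (new e′ q e′-edge e′-owned 0<q q<l)) (Δ₁ψ-new e′ q e′-edge e′-owned 0<q q<l)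

      fired₂-at-w : + 1 ≤ (D′ ⊕ Δ₁ g₂) w
      fired₂-at-w rewrite fired₂-split w =
        ℤP.≤-trans Δ₁ψ-peak (ℤP.i≤j+i _ _ {{ℤ.nonNegative (fired₁≥0 w (new e p e-edge owned 0<p p<l))}})

  remove-new-chip : ∀ e p → IsEdge e → own e ≡ true → 0 ℕ.< p → p ℕ.< l e →
    ∃ λ g → ∀ y → VertexH y → + 0 ≤ (D′ ⊕ Δ₁ g ⊖ chip (pos e p)) y
  remove-new-chip e p e-edge owned 0<p p<l = by-slope (σ ℤ.≟ + 0)
    where
      open NewVertexChip e p e-edge owned 0<p p<l
      by-slope : Dec (σ ≡ + 0) → ∃ λ g → ∀ y → VertexH y → + 0 ≤ (D′ ⊕ Δ₁ g ⊖ chip w) y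
      by-slope (no σ≢0) = g₁ , chip-removable fired₁ w fired₁≥0 (fired₁-at-w σ≢0)
      by-slope (yes σ≡0) = g₂ , chip-removable (D′ ⊕ Δ₁ g₂) w fired₂≥0 fired₂-at-w
        where open Flat σ≡0

  D′-divisor : IsDivisor graph D′
  D′-divisor (x , k) _ y-not-vertex with view (x , k)
  ... | original j v-vertex = contradiction (rH-original j v-vertex) y-not-vertex
  ... | half-edge e-edge _ = lift-edge D k e-edge
  ... | beyond e-edge j≮l = contradiction (rH-beyond e-edge j≮l) y-not-vertex

  deg-D′ : deg graph D′ ≡ deg Γ D
  deg-D′ = trans (ΣH-by-fibres _) (sum-cong (allFin n) λ x → fibre (isV x) refl)
    where
      fibre : ∀ {x} b → isV x ≡ b →
        sumBelow (λ k → if isVertex graph (x , k) then D′ (x , k) else + 0) (size x) ≡ (if b then D x else + 0)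
      fibre {x} true x-vertex = begin
        sumBelow atVertices (size x)  ≡⟨ cong (sumBelow atVertices) (size-old x-vertex) ⟩
        atVertices 0 + + 0            ≡⟨ ℤP.+-identityʳ _ ⟩
        atVertices 0                  ≡⟨ cong₂ (λ b d → if b then d else + 0) (isVertexH-original 0 x-vertex) (lift-old D 0 x-vertex) ⟩
        D x ∎
        where
          open ≡-Reasoning
          atVertices : ℕ → ℤ
          atVertices k = if isVertex graph (x , k) then D′ (x , k) else + 0
      fibre {x} false x-edge = sumBelow-zero _ (size x) λ k _ → vanish (isVertex graph (x , k)) (lift-edge D k x-edge)
        where
          vanish : ∀ b {d} → d ≡ + 0 → (if b then d else + 0) ≡ + 0
          vanish true d≡0 = d≡0
          vanish false _ = refl

  D′-rank≥1 : RankGeq graph (unitLength graph) D′ 1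
  D′-rank≥1 = rank≥1-if-chips-removable rH-idem iH-fixes-vertices D′ D′-divisor λ w w∈ w-vertex →
    on-vertices (remove-chip (vertexH-kind w w∈ w-vertex))
    where
      remove-chip : ∀ {w} → VertexH w → ∃ λ g → ∀ y → VertexH y → + 0 ≤ (D′ ⊕ Δ₁ g ⊖ chip w) y
      remove-chip (old v v-vertex) = remove-old-chip v v-vertex
      remove-chip (new e p e-edge owned 0<p p<l) = remove-new-chip e p e-edge owned 0<p p<l
      on-vertices : ∀ {w} → (∃ λ g → ∀ y → VertexH y → + 0 ≤ (D′ ⊕ Δ₁ g ⊖ chip w) y) →
        ∃ λ g → Vertex-Effective (D′ ⊕ Δ₁ g ⊖ chip w)
      on-vertices (g , ok) = g , λ y y∈ y-vertex → ok y (vertexH-kind y y∈ y-vertex)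

looplessMetricGraph : ∀ {n r i l} → IsGraph (FinGraph n r i) → IsMetric (FinGraph n r i) l → NoLoops (FinGraph n r i) →
  LooplessMetricGraph n r i l
looplessMetricGraph Γ-graph Γ-metric Γ-loopless = record
  { r-idem         = λ x → r-idem x (MP.∈-allFin x)
  ; i-invol        = λ x → i-invol x (MP.∈-allFin x)
  ; i-fixed⇒vertex = λ x → Equivalence.to (fix-iff x (MP.∈-allFin x))
  ; vertex⇒i-fixed = λ x → Equivalence.from (fix-iff x (MP.∈-allFin x))
  ; l-i            = λ x → l-i x (MP.∈-allFin x)
  ; l≡0⇒vertex     = λ x → Equivalence.to (l-zero x (MP.∈-allFin x))
  ; no-loop        = λ e → Γ-loopless e (MP.∈-allFin e)
  }
  where
    open IsGraph Γ-graph
    open IsMetric Γ-metric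

lemma4p10 : (n : ℕ) (r i : Fin n → Fin n) (l : Fin n → ℕ) →
    IsGraph (FinGraph n r i) → IsMetric (FinGraph n r i) l →
    NoLoops (FinGraph n r i) →
    (D : Fin n → ℤ) → IsDivisor (FinGraph n r i) D →
    RankGeq (FinGraph n r i) l D 1 →
    ∃ λ D' → IsDivisor (subdivide n r i l) D' ×
    RankGeq (subdivide n r i l) (unitLength (subdivide n r i l)) D' 1 ×
    deg (subdivide n r i l) D' ≤ deg (FinGraph n r i) D
lemma4p10 n r i l Γ-graph Γ-metric Γ-loopless D _ (j , 1≤j , rank-j) =
  D′ , D′-divisor , D′-rank≥1 , ℤP.≤-reflexive deg-D′
  where open ChipFiring (looplessMetricGraph Γ-graph Γ-metric Γ-loopless) D j 1≤j rank-j
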